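{- For each positive integer $k$, there exists a planar graph containing no cycle of length $4$ and no cycle of length $5$ that is not $(1,k)$-colorable.
   Context: For nonnegative integers $d_1,d_2$, a graph $G$ is $(d_1,d_2)$-colorable if $V(G)$ can be partitioned into two sets $V_1,V_2$ (possibly empty) such that the induced subgraph $G[V_1]$ has maximum degree at most $d_1$ and $G[V_2]$ has maximum degree at most $d_2$. -}

module Defs where

open import Data.Nat as ℕ using (ℕ; zero; suc)
open import Data.Fin using (Fin; zero; suc; inject₁; fromℕ)
open import Data.List using (map)
open import Data.Nat.ListAction using (sum)
open import Data.List.Base using (allFin)
open import Data.Bool using (Bool; true; false; not; _∧_; _xor_; if_then_else_)
open import Data.Empty using (⊥)
open import Data.Product using (Σ; _×_; _,_)
open import Data.Sum using (_⊎_)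
open import Data.Rational as ℚ using (ℚ; 0ℚ; 1ℚ)
open import Function.Definitions using (Injective)
open import Relation.Binary.PropositionalEquality using (_≡_)
open import Relation.Nullary using (¬_)

record Graph : Set where
  field
    n      : ℕ
    adj    : Fin n → Fin n → Bool
    sym    : ∀ u v → adj u v ≡ adj v u
    irrefl : ∀ v → adj v v ≡ false

Point : Set
Point = ℚ × ℚ

OnSegment : Point → Point → Point → Set
OnSegment (x₁ , x₂) (p₁ , p₂) (q₁ , q₂) =
  Σ ℚ λ t → (0ℚ ℚ.≤ t) × (t ℚ.≤ 1ℚ)
          × (x₁ ≡ p₁ ℚ.+ t ℚ.* (q₁ ℚ.- p₁))
          × (x₂ ≡ p₂ ℚ.+ t ℚ.* (q₂ ℚ.- p₂))

module _ (G : Graph) where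
  open Graph G

  V : Set
  V = Fin n

  Edge : V → V → Set
  Edge u v = adj u v ≡ true

  CycleOfLength+1 : ℕ → Set
  CycleOfLength+1 m =
    Σ (Fin (suc m) → V) λ c →
      Injective _≡_ _≡_ c
      × (∀ (i : Fin m) → Edge (c (inject₁ i)) (c (suc i)))
      × Edge (c (fromℕ m)) (c zero)

  HasCycle : ℕ → Set
  HasCycle zero                = ⊥
  HasCycle (suc zero)          = ⊥
  HasCycle (suc (suc zero))    = ⊥
  HasCycle (suc (suc (suc m))) = CycleOfLength+1 (suc (suc m))

  -- (d₁,d₂)-colorability.  A partition V = V₁ ⊔ V₂ is given by
  -- part : V → Bool (part v ≡ true  ⇔  v ∈ V₁).

  sameSide : (V → Bool) → V → V → Bool
  sameSide part u v = not (part u xor part v)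

  degInPart : (V → Bool) → V → ℕ
  degInPart part v =
    sum (map (λ u → if adj v u ∧ sameSide part u v then 1 else 0) (allFin n))

  Colorable : ℕ → ℕ → Set
  Colorable d₁ d₂ =
    Σ (V → Bool) λ part → ∀ v →
      (part v ≡ true  → degInPart part v ℕ.≤ d₁)
      × (part v ≡ false → degInPart part v ℕ.≤ d₂)

  IsStraightLineEmbedding : (V → Point) → Set
  IsStraightLineEmbedding pos =
    Injective _≡_ _≡_ pos
    × (∀ u v w → Edge u v → ¬ (w ≡ u) → ¬ (w ≡ v) →
         ¬ OnSegment (pos w) (pos u) (pos v))
    × (∀ u v x y (z : Point) → Edge u v → Edge x y →
         OnSegment z (pos u) (pos v) → OnSegment z (pos x) (pos y) →
         ((u ≡ x × v ≡ y) ⊎ (u ≡ y × v ≡ x))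
         ⊎ Σ V λ w → (w ≡ u ⊎ w ≡ v) × (w ≡ x ⊎ w ≡ y) × (z ≡ pos w))

  Planar : Set
  Planar = Σ (V → Point) IsStraightLineEmbedding

module Submission where

-- Let M = 2k+1.  A block has a hub h, an outer triangle w₀ w₁ w₂ and, for
-- j < 3 and i < M, a triangle h a_{ji} b_{ji} with a path a_{ji} e_{ji} w_j;
-- the graph consists of three blocks whose hubs form a triangle.
--   * Not (1,k)-colourable: a triangle never lies in V₁, so some hub h is in
--     V₂.  If a corner w_j were in V₂, then for every i either a_{ji} or
--     b_{ji} is a V₂-neighbour of h, or both are in V₁, forcing e_{ji} to be
--     a V₂-neighbour of w_j; so 2k+1 ≤ deg h + deg w_j ≤ 2k.  Hence the outer
--     triangle lies in V₁, a contradiction.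
--   * No 4- or 5-cycles: inspecting five consecutive vertices of such a
--     cycle shows that it avoids the links e_{ji}, and then that all its
--     vertices are hubs, of which there are only three.
--   * Planar: an explicit straight-line drawing at integer points; every
--     two edges are shown to meet only in a common end, using lines that
--     separate them.

open import Data.Nat using (ℕ; suc)

module Geometry where

  open import Defs using (Point; OnSegment)
  open import Data.Nat as ℕ using (ℕ; zero; suc)
  import Data.Nat.Properties as ℕP
  open import Data.Rational as ℚ using (ℚ; 0ℚ; 1ℚ; _+_; _*_; _-_; -_; _≤_; _<_; 1/_)
  open import Data.Rational.Properties
  open import Data.Rational.Solver using (module +-*-Solver)
  open +-*-Solver using (solve; con; _:+_; _:*_; _:-_; _:=_)
  open import Data.Empty using (⊥; ⊥-elim)
  open import Data.Sum using (inj₁; inj₂)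
  open import Data.Product using (_×_; _,_; proj₁; proj₂)
  open import Relation.Binary.PropositionalEquality
  open import Relation.Binary.Definitions using (tri<; tri≈; tri>)
  open import Relation.Nullary.Decidable using (toWitness)

  -- The two coordinate axes of the plane; lemmas about one coordinate of
  -- a segment are stated once for an arbitrary axis.
  data Axis : Set where
    xAxis yAxis : Axis

  coord : {A : Set} → Axis → A × A → A
  coord xAxis = proj₁
  coord yAxis = proj₂

  -- The embedding ℕ → ℚ.  It is abstract so that coordinates are never
  -- unfolded into normal forms of rationals during type checking; only the
  -- order properties below are used.
  abstract
    ι : ℕ → ℚ
    ι zero    = 0ℚ
    ι (suc n) = 1ℚ + ι n

    ι-<-suc : ∀ n → ι n < ι (suc n)
    ι-<-suc n = subst (_< 1ℚ + ι n) (+-identityˡ (ι n))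
                      (+-monoˡ-< (ι n) (toWitness {a? = 0ℚ <? 1ℚ} _))

    ι-mono-≤ : ∀ {m n} → m ℕ.≤ n → ι m ≤ ι n
    ι-mono-≤ {zero} {zero}  ℕ.z≤n = ≤-refl
    ι-mono-≤ {zero} {suc n} ℕ.z≤n = ≤-trans (ι-mono-≤ {zero} {n} ℕ.z≤n) (<⇒≤ (ι-<-suc n))
    ι-mono-≤ (ℕ.s≤s m≤n) = +-monoʳ-≤ 1ℚ (ι-mono-≤ m≤n)

  ι-mono-< : ∀ {m n} → m ℕ.< n → ι m < ι n
  ι-mono-< {m} m<n = <-≤-trans (ι-<-suc m) (ι-mono-≤ m<n)

  ι-injective : ∀ {m n} → ι m ≡ ι n → m ≡ n
  ι-injective {m} {n} e with ℕP.<-cmp m n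
  ... | tri< m<n _ _ = ⊥-elim (<-irrefl e (ι-mono-< m<n))
  ... | tri≈ _ m≡n _ = m≡n
  ... | tri> _ _ n<m = ⊥-elim (<-irrefl (sym e) (ι-mono-< n<m))

  ι-cancel-≤ : ∀ {m n} → ι m ≤ ι n → m ℕ.≤ n
  ι-cancel-≤ {m} {n} ιm≤ιn with ℕP.≤-<-connex m n
  ... | inj₁ m≤n = m≤n
  ... | inj₂ n<m = ⊥-elim (<-irrefl refl (<-≤-trans (ι-mono-< n<m) ιm≤ιn))

  LatticePoint : Set
  LatticePoint = ℕ × ℕ

  ⟦_⟧ : LatticePoint → Point
  ⟦ P ⟧ = ι (proj₁ P) , ι (proj₂ P)

  coord-⟦⟧ : ∀ a P → coord a ⟦ P ⟧ ≡ ι (coord a P)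
  coord-⟦⟧ xAxis P = refl
  coord-⟦⟧ yAxis P = refl

  ⟦⟧-injective : ∀ {P Q} → ⟦ P ⟧ ≡ ⟦ Q ⟧ → P ≡ Q
  ⟦⟧-injective e = cong₂ _,_ (ι-injective (cong proj₁ e)) (ι-injective (cong proj₂ e))

  interpolate : ℚ → ℚ → ℚ → ℚ
  interpolate p q t = p + t * (q - p)

  private
    1-t-nonNeg : ∀ {t} → t ≤ 1ℚ → 0ℚ ≤ 1ℚ - t
    1-t-nonNeg {t} t≤1 = subst (_≤ 1ℚ - t) (+-inverseʳ t) (+-monoˡ-≤ (- t) t≤1)

    1-t≤1 : ∀ {t} → 0ℚ ≤ t → 1ℚ - t ≤ 1ℚ
    1-t≤1 {t} 0≤t = subst₂ _≤_ (+-identityʳ (1ℚ - t))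
                      (solve 1 (λ t → (con 1ℚ :- t) :+ t := con 1ℚ) refl t)
                      (+-monoʳ-≤ (1ℚ - t) 0≤t)

    convex : ∀ p q t → interpolate p q t ≡ (1ℚ - t) * p + t * q
    convex = solve 3 (λ p q t → p :+ t :* (q :- p) := (con 1ℚ :- t) :* p :+ t :* q) refl

    split : ∀ t α → α ≡ (1ℚ - t) * α + t * α
    split = solve 2 (λ t α → α := (con 1ℚ :- t) :* α :+ t :* α) refl

  interpolate-≤ : ∀ {p q t α} → 0ℚ ≤ t → t ≤ 1ℚ → p ≤ α → q ≤ α → interpolate p q t ≤ α
  interpolate-≤ {p} {q} {t} {α} 0≤t t≤1 p≤α q≤α = begin
    interpolate p q t       ≡⟨ convex p q t ⟩
    (1ℚ - t) * p + t * q    ≤⟨ +-mono-≤ (*-monoˡ-≤-nonNeg (1ℚ - t) {{ℚ.nonNegative (1-t-nonNeg t≤1)}} p≤α)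
                                        (*-monoˡ-≤-nonNeg t {{ℚ.nonNegative 0≤t}} q≤α) ⟩
    (1ℚ - t) * α + t * α    ≡⟨ sym (split t α) ⟩
    α                       ∎
    where open ≤-Reasoning

  interpolate-≥ : ∀ {p q t α} → 0ℚ ≤ t → t ≤ 1ℚ → α ≤ p → α ≤ q → α ≤ interpolate p q t
  interpolate-≥ {p} {q} {t} {α} 0≤t t≤1 α≤p α≤q = begin
    α                       ≡⟨ split t α ⟩
    (1ℚ - t) * α + t * α    ≤⟨ +-mono-≤ (*-monoˡ-≤-nonNeg (1ℚ - t) {{ℚ.nonNegative (1-t-nonNeg t≤1)}} α≤p)
                                        (*-monoˡ-≤-nonNeg t {{ℚ.nonNegative 0≤t}} α≤q) ⟩
    (1ℚ - t) * p + t * q    ≡⟨ sym (convex p q t) ⟩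
    interpolate p q t       ∎
    where open ≤-Reasoning

  zero-product : ∀ {x c} → x * c ≡ 0ℚ → c ≢ 0ℚ → x ≡ 0ℚ
  zero-product {x} {c} xc≡0 c≢0 = begin
    x                        ≡⟨ sym (*-identityʳ x) ⟩
    x * 1ℚ                   ≡⟨ cong (x *_) (sym (*-inverseʳ c {{nz}})) ⟩
    x * (c * (1/ c) {{nz}})  ≡⟨ sym (*-assoc x c _) ⟩
    (x * c) * (1/ c) {{nz}}  ≡⟨ cong (_* (1/ c) {{nz}}) xc≡0 ⟩
    0ℚ * (1/ c) {{nz}}       ≡⟨ *-zeroˡ ((1/ c) {{nz}}) ⟩
    0ℚ                       ∎
    where
    open ≡-Reasoning
    nz = ℚ.≢-nonZero c≢0

  difference-≢0 : ∀ {q p} → q ≢ p → q - p ≢ 0ℚ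
  difference-≢0 {q} {p} q≢p q-p≡0 = q≢p (begin
    q             ≡⟨ solve 2 (λ q p → q := (q :- p) :+ p) refl q p ⟩
    (q - p) + p   ≡⟨ cong (_+ p) q-p≡0 ⟩
    0ℚ + p        ≡⟨ +-identityˡ p ⟩
    p             ∎)
    where open ≡-Reasoning

  private
    zero-difference : ∀ u c x y → u * c ≡ x - y → x ≡ y → c ≢ 0ℚ → u ≡ 0ℚ
    zero-difference u c x y e refl c≢0 = zero-product (trans e (+-inverseʳ x)) c≢0

  interpolate-start : ∀ {p q t} → interpolate p q t ≡ p → q ≢ p → t ≡ 0ℚ
  interpolate-start {p} {q} {t} e q≢p =
    zero-difference t (q - p) (interpolate p q t) p
      (solve 3 (λ p q t → t :* (q :- p) := (p :+ t :* (q :- p)) :- p) refl p q t) e (difference-≢0 q≢p)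

  interpolate-injective : ∀ {a b t s} → interpolate a b t ≡ interpolate a b s → b ≢ a → t ≡ s
  interpolate-injective {a} {b} {t} {s} e b≢a = begin
    t            ≡⟨ solve 2 (λ t s → t := (t :- s) :+ s) refl t s ⟩
    (t - s) + s  ≡⟨ cong (_+ s) t-s≡0 ⟩
    0ℚ + s       ≡⟨ +-identityˡ s ⟩
    s            ∎
    where
    open ≡-Reasoning
    t-s≡0 : t - s ≡ 0ℚ
    t-s≡0 = zero-difference (t - s) (b - a) (interpolate a b t) (interpolate a b s)
      (solve 4 (λ a b t s → (t :- s) :* (b :- a) := (a :+ t :* (b :- a)) :- (a :+ s :* (b :- a))) refl a b t s)
      e (difference-≢0 b≢a)

  interpolate-fan : ∀ {a p q t} → interpolate a p t ≡ interpolate a q t → p ≢ q → t ≡ 0ℚ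
  interpolate-fan {a} {p} {q} {t} e p≢q =
    zero-difference t (p - q) (interpolate a p t) (interpolate a q t)
      (solve 4 (λ a p q t → t :* (p :- q) := (a :+ t :* (p :- a)) :- (a :+ t :* (q :- a))) refl a p q t)
      e (difference-≢0 p≢q)

  interpolate-0 : ∀ p q → interpolate p q 0ℚ ≡ p
  interpolate-0 = solve 2 (λ p q → p :+ con 0ℚ :* (q :- p) := p) refl

  interpolate-reverse : ∀ p q t → interpolate p q t ≡ interpolate q p (1ℚ - t)
  interpolate-reverse = solve 3 (λ p q t → p :+ t :* (q :- p) := q :+ (con 1ℚ :- t) :* (p :- q)) refl

  on-axis : ∀ {z} p q (o : OnSegment z p q) a → coord a z ≡ interpolate (coord a p) (coord a q) (proj₁ o)
  on-axis p q o xAxis = proj₁ (proj₂ (proj₂ (proj₂ o)))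
  on-axis p q o yAxis = proj₂ (proj₂ (proj₂ (proj₂ o)))

  at-start : ∀ {z} p q (o : OnSegment z p q) → proj₁ o ≡ 0ℚ → z ≡ p
  at-start p q o t≡0 = cong₂ _,_ (at xAxis) (at yAxis)
    where
    at : ∀ a → coord a _ ≡ coord a p
    at a = trans (on-axis p q o a) (trans (cong (interpolate (coord a p) (coord a q)) t≡0)
                                          (interpolate-0 (coord a p) (coord a q)))

  start-on-segment : ∀ p q → OnSegment p p q
  start-on-segment p q = 0ℚ , ≤-refl , toWitness {a? = 0ℚ ≤? 1ℚ} _ ,
    sym (interpolate-0 (proj₁ p) (proj₁ q)) , sym (interpolate-0 (proj₂ p) (proj₂ q))

  onSegment-sym : ∀ {z} p q → OnSegment z p q → OnSegment z q p
  onSegment-sym p q o@(t , 0≤t , t≤1 , _) =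
    1ℚ - t , 1-t-nonNeg t≤1 , 1-t≤1 0≤t ,
    trans (on-axis p q o xAxis) (interpolate-reverse (proj₁ p) (proj₁ q) t) ,
    trans (on-axis p q o yAxis) (interpolate-reverse (proj₂ p) (proj₂ q) t)

  module Segments {V : Set} (pos : V → LatticePoint) where

    -- z lies on the segment between (the positions of) u and v; a record,
    -- so that u and v can be inferred from a proof.
    record On (z : Point) (u v : V) : Set where
      constructor on
      field segment : OnSegment z ⟦ pos u ⟧ ⟦ pos v ⟧

    On-sym : ∀ {z u v} → On z u v → On z v u
    On-sym {u = u} {v} (on o) = on (onSegment-sym ⟦ pos u ⟧ ⟦ pos v ⟧ o)

    module _ {z : Point} {u v : V} (o : On z u v) where
      private
        o′ = On.segment o
        t = proj₁ o′
        on-lattice-axis : ∀ a → coord a z ≡ interpolate (ι (coord a (pos u))) (ι (coord a (pos v))) t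
        on-lattice-axis a = trans (on-axis ⟦ pos u ⟧ ⟦ pos v ⟧ o′ a)
                                  (cong₂ (λ p q → interpolate p q t) (coord-⟦⟧ a (pos u)) (coord-⟦⟧ a (pos v)))

      bounded-above : ∀ a {α} → coord a (pos u) ℕ.≤ α → coord a (pos v) ℕ.≤ α → coord a z ≤ ι α
      bounded-above a u≤α v≤α = subst (_≤ _) (sym (on-lattice-axis a))
        (interpolate-≤ (proj₁ (proj₂ o′)) (proj₁ (proj₂ (proj₂ o′))) (ι-mono-≤ u≤α) (ι-mono-≤ v≤α))

      bounded-below : ∀ a {α} → α ℕ.≤ coord a (pos u) → α ℕ.≤ coord a (pos v) → ι α ≤ coord a z
      bounded-below a α≤u α≤v = subst (_ ≤_) (sym (on-lattice-axis a))
        (interpolate-≥ (proj₁ (proj₂ o′)) (proj₁ (proj₂ (proj₂ o′))) (ι-mono-≤ α≤u) (ι-mono-≤ α≤v))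

      start-by-coord : ∀ a → coord a z ≡ ι (coord a (pos u)) → coord a (pos v) ≢ coord a (pos u) →
                       z ≡ ⟦ pos u ⟧
      start-by-coord a e v≢u = at-start ⟦ pos u ⟧ ⟦ pos v ⟧ o′
        (interpolate-start (trans (sym (on-lattice-axis a)) e) (λ ιv≡ιu → v≢u (ι-injective ιv≡ιu)))

    end-by-coord : ∀ {z u v} → On z u v → ∀ a →
                   coord a z ≡ ι (coord a (pos v)) → coord a (pos u) ≢ coord a (pos v) → z ≡ ⟦ pos v ⟧
    end-by-coord o = start-by-coord (On-sym o)

    module _ {z : Point} {u v x y : V} (o : On z u v) (o′ : On z x y) (a : Axis) where
      meet-on-line : ∀ {α} → coord a (pos u) ℕ.≤ α → coord a (pos v) ℕ.≤ α →
                     α ℕ.≤ coord a (pos x) → α ℕ.≤ coord a (pos y) → coord a z ≡ ι α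
      meet-on-line u≤α v≤α α≤x α≤y = ≤-antisym (bounded-above o a u≤α v≤α) (bounded-below o′ a α≤x α≤y)

      separated : ∀ {α} → coord a (pos u) ℕ.≤ α → coord a (pos v) ℕ.≤ α →
                  suc α ℕ.≤ coord a (pos x) → suc α ℕ.≤ coord a (pos y) → ⊥
      separated {α} u≤α v≤α α<x α<y =
        <-irrefl refl (<-≤-trans (ι-<-suc α) (≤-trans (bounded-below o′ a α<x α<y) (bounded-above o a u≤α v≤α)))

    fan : ∀ {z c u v} → On z c u → On z c v → coord yAxis (pos u) ≡ coord yAxis (pos v) →
          coord yAxis (pos u) ≢ coord yAxis (pos c) → pos u ≢ pos v → z ≡ ⟦ pos c ⟧
    fan {z} {c} {u} {v} (on o) (on o′) uy≡vy uy≢cy u≢v = at-start ⟦ pos c ⟧ ⟦ pos u ⟧ o t≡0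
      where
      C = pos c
      t = proj₁ o
      s = proj₁ o′
      t≡s : t ≡ s
      t≡s = interpolate-injective
        (trans (sym (on-axis ⟦ C ⟧ ⟦ pos u ⟧ o yAxis)) (trans (on-axis ⟦ C ⟧ ⟦ pos v ⟧ o′ yAxis)
               (cong (λ y → interpolate (ι (proj₂ C)) (ι y) s) (sym uy≡vy))))
        (λ e → uy≢cy (ι-injective e))
      t≡0 : t ≡ 0ℚ
      t≡0 = interpolate-fan {a = ι (proj₁ C)}
        (trans (sym (on-axis ⟦ C ⟧ ⟦ pos u ⟧ o xAxis)) (trans (on-axis ⟦ C ⟧ ⟦ pos v ⟧ o′ xAxis)
               (cong (interpolate (ι (proj₁ C)) (ι (proj₁ (pos v)))) (sym t≡s))))
        (λ e → u≢v (cong₂ _,_ (ι-injective e) uy≡vy))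

module Construction (M : ℕ) where

  open import Data.Fin using (Fin; _≟_)
  open import Data.Product using (_×_; _,_)
  open import Relation.Binary.PropositionalEquality
  open import Relation.Nullary using (¬_; Dec; no; _×-dec_; ¬?)
  open import Relation.Nullary.Decidable using (map′)

  -- The pieces of one block: the hub, the three corners w₀ w₁ w₂ of the
  -- outer triangle, and for j < 3, i < M a triangle hub–a–b (fanA, fanB)
  -- together with a path a – link – w_j.
  data Piece : Set where
    hub    : Piece
    corner : Fin 3 → Piece
    fanA fanB link : Fin 3 → Fin M → Piece

  Vertex : Set
  Vertex = Fin 3 × Piece

  data Adj : Vertex → Vertex → Set where
    hub-hub       : ∀ {g g′} → g ≢ g′ → Adj (g , hub) (g′ , hub)
    hub-fanA      : ∀ {g j i} → Adj (g , hub) (g , fanA j i)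
    fanA-hub      : ∀ {g j i} → Adj (g , fanA j i) (g , hub)
    hub-fanB      : ∀ {g j i} → Adj (g , hub) (g , fanB j i)
    fanB-hub      : ∀ {g j i} → Adj (g , fanB j i) (g , hub)
    fanA-fanB     : ∀ {g j i} → Adj (g , fanA j i) (g , fanB j i)
    fanB-fanA     : ∀ {g j i} → Adj (g , fanB j i) (g , fanA j i)
    fanA-link     : ∀ {g j i} → Adj (g , fanA j i) (g , link j i)
    link-fanA     : ∀ {g j i} → Adj (g , link j i) (g , fanA j i)
    link-corner   : ∀ {g j i} → Adj (g , link j i) (g , corner j)
    corner-link   : ∀ {g j i} → Adj (g , corner j) (g , link j i)
    corner-corner : ∀ {g j j′} → j ≢ j′ → Adj (g , corner j) (g , corner j′)

  Adj-sym : ∀ {x y} → Adj x y → Adj y x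
  Adj-sym (hub-hub g≢g′)       = hub-hub (λ e → g≢g′ (sym e))
  Adj-sym hub-fanA             = fanA-hub
  Adj-sym fanA-hub             = hub-fanA
  Adj-sym hub-fanB             = fanB-hub
  Adj-sym fanB-hub             = hub-fanB
  Adj-sym fanA-fanB            = fanB-fanA
  Adj-sym fanB-fanA            = fanA-fanB
  Adj-sym fanA-link            = link-fanA
  Adj-sym link-fanA            = fanA-link
  Adj-sym link-corner          = corner-link
  Adj-sym corner-link          = link-corner
  Adj-sym (corner-corner j≢j′) = corner-corner (λ e → j≢j′ (sym e))

  Adj-irrefl : ∀ {x} → ¬ Adj x x
  Adj-irrefl (hub-hub g≢g)       = g≢g refl
  Adj-irrefl (corner-corner j≢j) = j≢j refl

  adj? : ∀ x y → Dec (Adj x y)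
  adj? (g , hub) (g′ , hub) =
    map′ hub-hub (λ { (hub-hub g≢g′) → g≢g′ }) (¬? (g ≟ g′))
  adj? (g , hub) (g′ , fanA j i) = map′ (λ { refl → hub-fanA }) (λ { hub-fanA → refl }) (g ≟ g′)
  adj? (g , hub) (g′ , fanB j i) = map′ (λ { refl → hub-fanB }) (λ { hub-fanB → refl }) (g ≟ g′)
  adj? (g , fanA j i) (g′ , hub) = map′ (λ { refl → fanA-hub }) (λ { fanA-hub → refl }) (g ≟ g′)
  adj? (g , fanB j i) (g′ , hub) = map′ (λ { refl → fanB-hub }) (λ { fanB-hub → refl }) (g ≟ g′)
  adj? (g , fanA j i) (g′ , fanB j′ i′) =
    map′ (λ { (refl , refl , refl) → fanA-fanB }) (λ { fanA-fanB → refl , refl , refl })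
         (g ≟ g′ ×-dec j ≟ j′ ×-dec i ≟ i′)
  adj? (g , fanB j i) (g′ , fanA j′ i′) =
    map′ (λ { (refl , refl , refl) → fanB-fanA }) (λ { fanB-fanA → refl , refl , refl })
         (g ≟ g′ ×-dec j ≟ j′ ×-dec i ≟ i′)
  adj? (g , fanA j i) (g′ , link j′ i′) =
    map′ (λ { (refl , refl , refl) → fanA-link }) (λ { fanA-link → refl , refl , refl })
         (g ≟ g′ ×-dec j ≟ j′ ×-dec i ≟ i′)
  adj? (g , link j i) (g′ , fanA j′ i′) =
    map′ (λ { (refl , refl , refl) → link-fanA }) (λ { link-fanA → refl , refl , refl })
         (g ≟ g′ ×-dec j ≟ j′ ×-dec i ≟ i′)
  adj? (g , link j i) (g′ , corner j′) =
    map′ (λ { (refl , refl) → link-corner }) (λ { link-corner → refl , refl }) (g ≟ g′ ×-dec j ≟ j′)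
  adj? (g , corner j) (g′ , link j′ i′) =
    map′ (λ { (refl , refl) → corner-link }) (λ { corner-link → refl , refl }) (g ≟ g′ ×-dec j ≟ j′)
  adj? (g , corner j) (g′ , corner j′) =
    map′ (λ { (refl , j≢j′) → corner-corner j≢j′ }) (λ { (corner-corner j≢j′) → refl , j≢j′ })
         (g ≟ g′ ×-dec ¬? (j ≟ j′))
  adj? (_ , hub)      (_ , corner _) = no λ ()
  adj? (_ , hub)      (_ , link _ _) = no λ ()
  adj? (_ , corner _) (_ , hub)      = no λ ()
  adj? (_ , corner _) (_ , fanA _ _) = no λ ()
  adj? (_ , corner _) (_ , fanB _ _) = no λ ()
  adj? (_ , fanA _ _) (_ , corner _) = no λ ()
  adj? (_ , fanA _ _) (_ , fanA _ _) = no λ ()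
  adj? (_ , fanB _ _) (_ , corner _) = no λ ()
  adj? (_ , fanB _ _) (_ , fanB _ _) = no λ ()
  adj? (_ , fanB _ _) (_ , link _ _) = no λ ()
  adj? (_ , link _ _) (_ , hub)      = no λ ()
  adj? (_ , link _ _) (_ , fanB _ _) = no λ ()
  adj? (_ , link _ _) (_ , link _ _) = no λ ()

module Encoding (M : ℕ) where

  open Construction M
  open import Data.Nat using (_+_; _*_)
  open import Data.Fin using (Fin; zero)
  open import Data.Fin.Patterns using (0F; 1F; 2F)
  open import Data.Fin.Properties using (+↔⊎; *↔×)
  open import Data.Product using (_×_; _,_)
  open import Data.Sum using (_⊎_; inj₁; inj₂)
  open import Data.Sum.Function.Propositional using (_⊎-↔_)
  open import Data.Product.Function.NonDependent.Propositional using (_×-↔_)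
  open import Function.Bundles using (_↔_; mk↔ₛ′; Inverse)
  open import Function.Properties.Inverse using (↔-refl; ↔-sym; ↔-trans)
  open import Relation.Binary.PropositionalEquality

  Piece↔Sum : Piece ↔ (Fin 1 ⊎ (Fin 3 ⊎ (Fin 3 × (Fin 3 × Fin M))))
  Piece↔Sum = mk↔ₛ′ to from to-from from-to
    where
    to : Piece → Fin 1 ⊎ (Fin 3 ⊎ (Fin 3 × (Fin 3 × Fin M)))
    to hub        = inj₁ zero
    to (corner j) = inj₂ (inj₁ j)
    to (fanA j i) = inj₂ (inj₂ (0F , j , i))
    to (fanB j i) = inj₂ (inj₂ (1F , j , i))
    to (link j i) = inj₂ (inj₂ (2F , j , i))
    from : Fin 1 ⊎ (Fin 3 ⊎ (Fin 3 × (Fin 3 × Fin M))) → Piece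
    from (inj₁ _)                   = hub
    from (inj₂ (inj₁ j))            = corner j
    from (inj₂ (inj₂ (0F , j , i))) = fanA j i
    from (inj₂ (inj₂ (1F , j , i))) = fanB j i
    from (inj₂ (inj₂ (2F , j , i))) = link j i
    to-from : ∀ s → to (from s) ≡ s
    to-from (inj₁ zero)                = refl
    to-from (inj₂ (inj₁ j))            = refl
    to-from (inj₂ (inj₂ (0F , j , i))) = refl
    to-from (inj₂ (inj₂ (1F , j , i))) = refl
    to-from (inj₂ (inj₂ (2F , j , i))) = refl
    from-to : ∀ p → from (to p) ≡ p
    from-to hub        = refl
    from-to (corner j) = refl
    from-to (fanA j i) = refl
    from-to (fanB j i) = refl
    from-to (link j i) = refl

  blockSize : ℕ
  blockSize = 1 + (3 + 3 * (3 * M))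

  N : ℕ
  N = 3 * blockSize

  Piece↔Fin : Piece ↔ Fin blockSize
  Piece↔Fin = ↔-trans Piece↔Sum
    (↔-sym (↔-trans +↔⊎ (↔-refl ⊎-↔ ↔-trans +↔⊎ (↔-refl ⊎-↔ ↔-trans *↔× (↔-refl ×-↔ *↔×)))))

  Vertex↔Fin : Vertex ↔ Fin N
  Vertex↔Fin = ↔-sym (↔-trans *↔× (↔-refl ×-↔ ↔-sym Piece↔Fin))

  -- Kept abstract, so that the numbering is never computed: only the two
  -- inverse laws are used.
  abstract
    encode : Vertex → Fin N
    encode = Inverse.to Vertex↔Fin

    decode : Fin N → Vertex
    decode = Inverse.from Vertex↔Fin

    decode-encode : ∀ v → decode (encode v) ≡ v
    decode-encode = Inverse.strictlyInverseʳ Vertex↔Fin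

    encode-decode : ∀ x → encode (decode x) ≡ x
    encode-decode = Inverse.strictlyInverseˡ Vertex↔Fin

  encode-injective : ∀ {u v} → encode u ≡ encode v → u ≡ v
  encode-injective {u} {v} e = trans (sym (decode-encode u)) (trans (cong decode e) (decode-encode v))

  decode-injective : ∀ {x y} → decode x ≡ decode y → x ≡ y
  decode-injective {x} {y} e = trans (sym (encode-decode x)) (trans (cong encode e) (encode-decode y))

module GraphG (M : ℕ) where

  open import Defs using (Graph; Edge)
  open Construction M
  open Encoding M
  open import Relation.Binary.PropositionalEquality
  open import Relation.Nullary using (Dec; yes; no; does)
  open import Relation.Nullary.Decidable using (dec-true; dec-false)
  open import Data.Empty using (⊥-elim)

  does-sym : ∀ {A : Set} {R : A → A → Set} → (∀ {x y} → R x y → R y x) →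
             (R? : ∀ x y → Dec (R x y)) → ∀ x y → does (R? x y) ≡ does (R? y x)
  does-sym R-sym R? x y with R? x y | R? y x
  ... | yes _   | yes _   = refl
  ... | no _    | no _    = refl
  ... | yes rxy | no ¬ryx = ⊥-elim (¬ryx (R-sym rxy))
  ... | no ¬rxy | yes ryx = ⊥-elim (¬rxy (R-sym ryx))

  G : Graph
  G = record
    { n      = N
    ; adj    = λ u v → does (adj? (decode u) (decode v))
    ; sym    = λ u v → does-sym Adj-sym adj? (decode u) (decode v)
    ; irrefl = λ v → dec-false (adj? (decode v) (decode v)) Adj-irrefl
    }

  edge⇒Adj : ∀ {u v} → Edge G u v → Adj (decode u) (decode v)
  edge⇒Adj {u} {v} e with adj? (decode u) (decode v)
  ... | yes a = a

  Adj⇒edge : ∀ {x y} → Adj x y → Edge G (encode x) (encode y)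
  Adj⇒edge {x} {y} a = dec-true (adj? (decode (encode x)) (decode (encode y)))
                                (subst₂ Adj (sym (decode-encode x)) (sym (decode-encode y)) a)

module ShortCycles (M : ℕ) where

  open Construction M
  import Data.Nat as ℕ
  open import Data.Fin using (Fin)
  open import Data.Fin.Patterns using (0F; 1F; 2F; 3F; 4F)
  open import Data.Fin.Properties using (pigeonhole)
  open import Data.Product using (Σ; _,_)
  open import Data.Sum using (_⊎_; inj₁; inj₂)
  open import Data.Empty using (⊥; ⊥-elim)
  open import Relation.Nullary using (¬_)
  open import Relation.Binary.PropositionalEquality

  no-four-distinct : ∀ {a b c d : Fin 3} → a ≢ b → a ≢ c → a ≢ d → b ≢ c → b ≢ d → c ≢ d → ⊥
  no-four-distinct {a} {b} {c} {d} a≢b a≢c a≢d b≢c b≢d c≢d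
    with pigeonhole (ℕ.s≤s (ℕ.s≤s (ℕ.s≤s (ℕ.s≤s ℕ.z≤n)))) value
    where
    value : Fin 4 → Fin 3
    value 0F = a
    value 1F = b
    value 2F = c
    value 3F = d
  ... | 0F , 1F , _ , e = a≢b e
  ... | 0F , 2F , _ , e = a≢c e
  ... | 0F , 3F , _ , e = a≢d e
  ... | 1F , 2F , _ , e = b≢c e
  ... | 1F , 3F , _ , e = b≢d e
  ... | 2F , 3F , _ , e = c≢d e
  ... | 0F , 0F , () , _
  ... | 1F , 0F , () , _
  ... | 1F , 1F , ℕ.s≤s () , _
  ... | 2F , 0F , () , _
  ... | 2F , 1F , ℕ.s≤s () , _
  ... | 2F , 2F , ℕ.s≤s (ℕ.s≤s ()) , _
  ... | 3F , 0F , () , _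
  ... | 3F , 1F , ℕ.s≤s () , _
  ... | 3F , 2F , ℕ.s≤s (ℕ.s≤s ()) , _
  ... | 3F , 3F , ℕ.s≤s (ℕ.s≤s (ℕ.s≤s ())) , _

  -- Hubs and fanB's only have neighbours among hubs, fanA's and fanB's,
  -- while corners and links only have neighbours among corners, links and
  -- fanA's; so a walk from the one kind to the other takes two steps.
  data Low : Vertex → Set where
    hub  : ∀ {g} → Low (g , hub)
    fanB : ∀ {g j i} → Low (g , fanB j i)

  data High : Vertex → Set where
    corner : ∀ {g j} → High (g , corner j)
    link   : ∀ {g j i} → High (g , link j i)

  low-not-near-high : ∀ {x y} → Low x → High y → x ≡ y ⊎ Adj x y → ⊥
  low-not-near-high hub  ()   (inj₁ refl)
  low-not-near-high fanB ()   (inj₁ refl)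
  low-not-near-high hub  ()   (inj₂ (hub-hub _))
  low-not-near-high hub  ()   (inj₂ hub-fanA)
  low-not-near-high hub  ()   (inj₂ hub-fanB)
  low-not-near-high fanB ()   (inj₂ fanB-hub)
  low-not-near-high fanB ()   (inj₂ fanB-fanA)

  NotLink : Vertex → Set
  NotLink x = ∀ {g j i} → x ≢ (g , link j i)

  -- Five consecutive vertices x₋₂ … x₂ of a cycle of length 4 or 5: for
  -- length 4 the ends coincide, for length 5 they are adjacent.  The
  -- inequalities listed hold in every cycle of length at least 4 (the
  -- remaining ones between neighbours follow from irreflexivity).
  record Window (x₋₂ x₋₁ x₀ x₁ x₂ : Vertex) : Set where
    constructor window
    field
      e₋₂     : Adj x₋₂ x₋₁
      e₋₁     : Adj x₋₁ x₀
      e₀      : Adj x₀ x₁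
      e₁      : Adj x₁ x₂
      closing : x₂ ≡ x₋₂ ⊎ Adj x₂ x₋₂
      x₋₁≢x₁  : x₋₁ ≢ x₁
      x₋₁≢x₂  : x₋₁ ≢ x₂
      x₀≢x₂   : x₀ ≢ x₂
      x₋₂≢x₀  : x₋₂ ≢ x₀
      x₋₂≢x₁  : x₋₂ ≢ x₁

  reverse : ∀ {x₋₂ x₋₁ x₀ x₁ x₂} → Window x₋₂ x₋₁ x₀ x₁ x₂ → Window x₂ x₁ x₀ x₋₁ x₋₂
  reverse (window e₋₂ e₋₁ e₀ e₁ closing x₋₁≢x₁ x₋₁≢x₂ x₀≢x₂ x₋₂≢x₀ x₋₂≢x₁) =
    window (Adj-sym e₁) (Adj-sym e₀) (Adj-sym e₋₁) (Adj-sym e₋₂) (swap closing)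
           (λ e → x₋₁≢x₁ (sym e)) (λ e → x₋₂≢x₁ (sym e)) (λ e → x₋₂≢x₀ (sym e))
           (λ e → x₀≢x₂ (sym e)) (λ e → x₋₁≢x₂ (sym e))
    where
    swap : ∀ {x y} → x ≡ y ⊎ Adj x y → y ≡ x ⊎ Adj y x
    swap (inj₁ e) = inj₁ (sym e)
    swap (inj₂ a) = inj₂ (Adj-sym a)

  -- The centre of a window is never a link: the cycle would have to get
  -- from the corner w_j back to a_{ji} in two or three steps avoiding the
  -- link e_{ji}; but the other neighbours of a_{ji} are Low and those of
  -- w_j are High.
  private
    corner-link-fanA : ∀ {x₋₂ x₂ g j i} → ¬ Window x₋₂ (g , corner j) (g , link j i) (g , fanA j i) x₂
    corner-link-fanA (window e₋₂ _ _ e₁ closing _ _ x₀≢x₂ _ _) =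
      low-not-near-high (low e₁ x₀≢x₂) (high e₋₂) closing
      where
      low : ∀ {g j i y} → Adj (g , fanA j i) y → (g , link j i) ≢ y → Low y
      low fanA-hub  _  = hub
      low fanA-fanB _  = fanB
      low fanA-link ne = ⊥-elim (ne refl)
      high : ∀ {g j y} → Adj y (g , corner j) → High y
      high link-corner       = link
      high (corner-corner _) = corner

  centre-not-link : ∀ {x₋₂ x₋₁ x₀ x₁ x₂} → Window x₋₂ x₋₁ x₀ x₁ x₂ → NotLink x₀
  centre-not-link (window _ fanA-link   link-fanA   _ _ x₋₁≢x₁ _ _ _ _) refl = x₋₁≢x₁ refl
  centre-not-link (window _ corner-link link-corner _ _ x₋₁≢x₁ _ _ _ _) refl = x₋₁≢x₁ refl
  centre-not-link w@(window _ corner-link link-fanA _ _ _ _ _ _ _) refl = corner-link-fanA w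
  centre-not-link w@(window _ fanA-link link-corner _ _ _ _ _ _ _) refl = corner-link-fanA (reverse w)

  -- In a window without links, the centre is not a corner: the four middle
  -- vertices would be distinct corners of one block, which has only three.
  centre-not-corner : ∀ {x₋₂ x₋₁ x₁ x₂ g j} → Window x₋₂ x₋₁ (g , corner j) x₁ x₂ →
                      NotLink x₋₁ → NotLink x₁ → NotLink x₂ → ⊥
  centre-not-corner (window _ link-corner _ _ _ _ _ _ _ _) n₋₁ _ _ = n₋₁ refl
  centre-not-corner (window _ _ corner-link _ _ _ _ _ _ _) _ n₁ _ = n₁ refl
  centre-not-corner (window _ (corner-corner _) (corner-corner _) corner-link _ _ _ _ _ _) _ _ n₂ = n₂ refl
  centre-not-corner (window _ (corner-corner a≢b) (corner-corner b≢c) (corner-corner c≢d) _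
                            x₋₁≢x₁ x₋₁≢x₂ x₀≢x₂ _ _) _ _ _ =
    no-four-distinct a≢b (λ e → x₋₁≢x₁ (cong corner′ e)) (λ e → x₋₁≢x₂ (cong corner′ e))
                     b≢c (λ e → x₀≢x₂ (cong corner′ e)) c≢d
    where
    corner′ = λ j → (_ , corner j)

  -- In a window without links, the centre is not a fanA or fanB vertex:
  -- its two neighbours are the hub and its partner in the triangle, and the
  -- next vertex beyond the partner would repeat one of the three.
  centre-not-fanA : ∀ {x₋₂ x₋₁ x₁ x₂ g j i} → Window x₋₂ x₋₁ (g , fanA j i) x₁ x₂ →
                    NotLink x₋₁ → NotLink x₁ → ⊥
  centre-not-fanA (window _ link-fanA _ _ _ _ _ _ _ _) n₋₁ _ = n₋₁ refl
  centre-not-fanA (window _ _ fanA-link _ _ _ _ _ _ _) _ n₁ = n₁ refl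
  centre-not-fanA (window _ hub-fanA  fanA-hub  _ _ x₋₁≢x₁ _ _ _ _) _ _ = x₋₁≢x₁ refl
  centre-not-fanA (window _ fanB-fanA fanA-fanB _ _ x₋₁≢x₁ _ _ _ _) _ _ = x₋₁≢x₁ refl
  centre-not-fanA (window hub-fanB  fanB-fanA fanA-hub _ _ _ _ _ _ x₋₂≢x₁) _ _ = x₋₂≢x₁ refl
  centre-not-fanA (window fanA-fanB fanB-fanA fanA-hub _ _ _ _ _ x₋₂≢x₀ _) _ _ = x₋₂≢x₀ refl
  centre-not-fanA (window _ hub-fanA fanA-fanB fanB-hub  _ _ x₋₁≢x₂ _ _ _) _ _ = x₋₁≢x₂ refl
  centre-not-fanA (window _ hub-fanA fanA-fanB fanB-fanA _ _ _ x₀≢x₂ _ _) _ _ = x₀≢x₂ refl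

  centre-not-fanB : ∀ {x₋₂ x₋₁ x₁ x₂ g j i} → Window x₋₂ x₋₁ (g , fanB j i) x₁ x₂ →
                    NotLink x₋₂ → NotLink x₂ → ⊥
  centre-not-fanB (window _ hub-fanB  fanB-hub  _ _ x₋₁≢x₁ _ _ _ _) _ _ = x₋₁≢x₁ refl
  centre-not-fanB (window _ fanA-fanB fanB-fanA _ _ x₋₁≢x₁ _ _ _ _) _ _ = x₋₁≢x₁ refl
  centre-not-fanB (window hub-fanA  fanA-fanB fanB-hub _ _ _ _ _ _ x₋₂≢x₁) _ _ = x₋₂≢x₁ refl
  centre-not-fanB (window fanB-fanA fanA-fanB fanB-hub _ _ _ _ _ x₋₂≢x₀ _) _ _ = x₋₂≢x₀ refl
  centre-not-fanB (window link-fanA fanA-fanB fanB-hub _ _ _ _ _ _ _) n₋₂ _ = n₋₂ refl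
  centre-not-fanB (window _ hub-fanB fanB-fanA fanA-hub  _ _ x₋₁≢x₂ _ _ _) _ _ = x₋₁≢x₂ refl
  centre-not-fanB (window _ hub-fanB fanB-fanA fanA-fanB _ _ _ x₀≢x₂ _ _) _ _ = x₀≢x₂ refl
  centre-not-fanB (window _ hub-fanB fanB-fanA fanA-link _ _ _ _ _ _) _ n₂ = n₂ refl

  IsHub : Vertex → Set
  IsHub x = Σ (Fin 3) λ g → x ≡ (g , hub)

  centre-hub : ∀ {x₋₂ x₋₁ x₀ x₁ x₂} → Window x₋₂ x₋₁ x₀ x₁ x₂ →
               NotLink x₋₂ → NotLink x₋₁ → NotLink x₁ → NotLink x₂ → IsHub x₀
  centre-hub {x₀ = g , hub}      _ _   _   _  _  = g , refl
  centre-hub {x₀ = g , corner j} w _   n₋₁ n₁ n₂ = ⊥-elim (centre-not-corner w n₋₁ n₁ n₂)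
  centre-hub {x₀ = g , fanA j i} w _   n₋₁ n₁ _  = ⊥-elim (centre-not-fanA w n₋₁ n₁)
  centre-hub {x₀ = g , fanB j i} w n₋₂ _   _  n₂ = ⊥-elim (centre-not-fanB w n₋₂ n₂)
  centre-hub {x₀ = g , link j i} w _   _   _  _  = ⊥-elim (centre-not-link w refl)

  not-four-hubs : ∀ {x₋₂ x₋₁ x₀ x₁ x₂} → Window x₋₂ x₋₁ x₀ x₁ x₂ →
                  IsHub x₋₁ → IsHub x₀ → IsHub x₁ → IsHub x₂ → ⊥
  not-four-hubs (window _ (hub-hub a≢b) (hub-hub b≢c) (hub-hub c≢d) _ x₋₁≢x₁ x₋₁≢x₂ x₀≢x₂ _ _)
                (_ , refl) (_ , refl) (_ , refl) (_ , refl) =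
    no-four-distinct a≢b (λ e → x₋₁≢x₁ (cong hub′ e)) (λ e → x₋₁≢x₂ (cong hub′ e))
                     b≢c (λ e → x₀≢x₂ (cong hub′ e)) c≢d
    where
    hub′ = λ g → (g , hub)

  record Cycle {L : ℕ} (next : Fin L → Fin L) : Set where
    field
      vertex    : Fin L → Vertex
      injective : ∀ {p q} → vertex p ≡ vertex q → p ≡ q
      step      : ∀ p → Adj (vertex p) (vertex (next p))

    apart : ∀ {p q} → p ≢ q → vertex p ≢ vertex q
    apart p≢q e = p≢q (injective e)
  open Cycle

  rotate : ∀ {L} {next prev : Fin L → Fin L} → (∀ p → prev (next p) ≡ p) → Cycle next → Cycle next
  rotate {next = next} {prev} prev-next C = record
    { vertex    = λ p → vertex C (next p)
    ; injective = λ {p} {q} e → trans (sym (prev-next p)) (trans (cong prev (injective C e)) (prev-next q))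
    ; step      = λ p → step C (next p)
    }

  next₄ prev₄ : Fin 4 → Fin 4
  next₄ 0F = 1F
  next₄ 1F = 2F
  next₄ 2F = 3F
  next₄ 3F = 0F
  prev₄ 0F = 3F
  prev₄ 1F = 0F
  prev₄ 2F = 1F
  prev₄ 3F = 2F

  rotate₄ : Cycle next₄ → Cycle next₄
  rotate₄ = rotate {prev = prev₄} prev-next₄
    where
    prev-next₄ : ∀ p → prev₄ (next₄ p) ≡ p
    prev-next₄ 0F = refl
    prev-next₄ 1F = refl
    prev-next₄ 2F = refl
    prev-next₄ 3F = refl

  window₄ : (C : Cycle next₄) → let v = vertex C in Window (v 2F) (v 3F) (v 0F) (v 1F) (v 2F)
  window₄ C = window (step C 2F) (step C 3F) (step C 0F) (step C 1F) (inj₁ refl)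
                     (apart C λ ()) (apart C λ ()) (apart C λ ()) (apart C λ ()) (apart C λ ())

  everywhere₄ : (P : Vertex → Set) → (∀ (C : Cycle next₄) → P (vertex C 0F)) →
                ∀ (C : Cycle next₄) p → P (vertex C p)
  everywhere₄ P start C 0F = start C
  everywhere₄ P start C 1F = start (rotate₄ C)
  everywhere₄ P start C 2F = start (rotate₄ (rotate₄ C))
  everywhere₄ P start C 3F = start (rotate₄ (rotate₄ (rotate₄ C)))

  no-4-cycle : Cycle next₄ → ⊥
  no-4-cycle C = not-four-hubs (window₄ C) (hubs C 3F) (hubs C 0F) (hubs C 1F) (hubs C 2F)
    where
    link-free : ∀ (C : Cycle next₄) p → NotLink (vertex C p)
    link-free = everywhere₄ NotLink λ C → centre-not-link (window₄ C)
    hubs : ∀ (C : Cycle next₄) p → IsHub (vertex C p)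
    hubs = everywhere₄ IsHub λ C →
      centre-hub (window₄ C) (link-free C 2F) (link-free C 3F) (link-free C 1F) (link-free C 2F)

  next₅ prev₅ : Fin 5 → Fin 5
  next₅ 0F = 1F
  next₅ 1F = 2F
  next₅ 2F = 3F
  next₅ 3F = 4F
  next₅ 4F = 0F
  prev₅ 0F = 4F
  prev₅ 1F = 0F
  prev₅ 2F = 1F
  prev₅ 3F = 2F
  prev₅ 4F = 3F

  rotate₅ : Cycle next₅ → Cycle next₅
  rotate₅ = rotate {prev = prev₅} prev-next₅
    where
    prev-next₅ : ∀ p → prev₅ (next₅ p) ≡ p
    prev-next₅ 0F = refl
    prev-next₅ 1F = refl
    prev-next₅ 2F = refl
    prev-next₅ 3F = refl
    prev-next₅ 4F = refl

  window₅ : (C : Cycle next₅) → let v = vertex C in Window (v 3F) (v 4F) (v 0F) (v 1F) (v 2F)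
  window₅ C = window (step C 3F) (step C 4F) (step C 0F) (step C 1F) (inj₂ (step C 2F))
                     (apart C λ ()) (apart C λ ()) (apart C λ ()) (apart C λ ()) (apart C λ ())

  everywhere₅ : (P : Vertex → Set) → (∀ (C : Cycle next₅) → P (vertex C 0F)) →
                ∀ (C : Cycle next₅) p → P (vertex C p)
  everywhere₅ P start C 0F = start C
  everywhere₅ P start C 1F = start (rotate₅ C)
  everywhere₅ P start C 2F = start (rotate₅ (rotate₅ C))
  everywhere₅ P start C 3F = start (rotate₅ (rotate₅ (rotate₅ C)))
  everywhere₅ P start C 4F = start (rotate₅ (rotate₅ (rotate₅ (rotate₅ C))))

  no-5-cycle : Cycle next₅ → ⊥
  no-5-cycle C = not-four-hubs (window₅ C) (hubs C 4F) (hubs C 0F) (hubs C 1F) (hubs C 2F)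
    where
    link-free : ∀ (C : Cycle next₅) p → NotLink (vertex C p)
    link-free = everywhere₅ NotLink λ C → centre-not-link (window₅ C)
    hubs : ∀ (C : Cycle next₅) p → IsHub (vertex C p)
    hubs = everywhere₅ IsHub λ C →
      centre-hub (window₅ C) (link-free C 3F) (link-free C 4F) (link-free C 1F) (link-free C 2F)

module CyclesOfG (M : ℕ) where
  open import Defs using (HasCycle)
  open import Data.Fin.Patterns using (0F; 1F; 2F; 3F; 4F)
  open import Data.Product using (_,_)
  open import Relation.Nullary using (¬_)
  open Encoding M using (decode; decode-injective)
  open GraphG M
  open ShortCycles M

  no-C4 : ¬ HasCycle G 4
  no-C4 (c , injective , steps , last) = no-4-cycle record
    { vertex    = λ p → decode (c p)
    ; injective = λ e → injective (decode-injective e)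
    ; step      = λ { 0F → edge⇒Adj (steps 0F) ; 1F → edge⇒Adj (steps 1F) ; 2F → edge⇒Adj (steps 2F)
                    ; 3F → edge⇒Adj last }
    }

  no-C5 : ¬ HasCycle G 5
  no-C5 (c , injective , steps , last) = no-5-cycle record
    { vertex    = λ p → decode (c p)
    ; injective = λ e → injective (decode-injective e)
    ; step      = λ { 0F → edge⇒Adj (steps 0F) ; 1F → edge⇒Adj (steps 1F) ; 2F → edge⇒Adj (steps 2F)
                    ; 3F → edge⇒Adj (steps 3F) ; 4F → edge⇒Adj last }
    }

module Colouring (k : ℕ) where

  open import Data.Nat using (suc; _+_; _≤_; z≤n; s≤s)

  M : ℕ
  M = suc (k + k)

  open import Defs using (Graph; Colorable; degInPart; sameSide)
  open Construction M
  open Encoding M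
  open GraphG M
  import Data.Nat.Properties as ℕP
  open import Data.Fin using (Fin; zero; suc; _≟_)
  open import Data.Fin.Patterns using (0F; 1F; 2F)
  open import Data.Bool using (Bool; true; false; not; _∧_; _xor_; if_then_else_)
  open import Data.List using (List; []; _∷_; length; map; tabulate; allFin)
  open import Data.List.Properties using (map-tabulate; length-map; length-tabulate)
  open import Data.Nat.ListAction using (sum)
  open import Data.List.Relation.Unary.All using (All; []; _∷_)
  import Data.List.Relation.Unary.All as All
  import Data.List.Relation.Unary.All.Properties as All
  open import Data.List.Relation.Unary.AllPairs using ([]; _∷_)
  open import Data.List.Relation.Unary.Unique.Propositional using (Unique)
  import Data.List.Relation.Unary.Unique.Propositional.Properties as Unique
  open import Data.Product using (Σ; _×_; _,_; proj₁; proj₂)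
  open import Data.Sum using (_⊎_; inj₁; inj₂)
  open import Data.Empty using (⊥; ⊥-elim)
  open import Relation.Binary.PropositionalEquality
  open import Function using (id)
  open import Relation.Nullary using (¬_; does; yes; no)
  open import Algebra.Properties.CommutativeSemigroup ℕP.+-commutativeSemigroup using (interchange; x∙yz≈y∙xz)

  -- Counting.  A duplicate-free list of points where f is positive is no
  -- longer than the total sum of f; proved by removing one point at a time.
  without : ∀ {n} → Fin n → (Fin n → ℕ) → Fin n → ℕ
  without u f w = if does (w ≟ u) then 0 else f w

  without-≢ : ∀ {n} {u w : Fin n} (f : Fin n → ℕ) → u ≢ w → without u f w ≡ f w
  without-≢ {u = u} {w} f u≢w with w ≟ u
  ... | yes w≡u = ⊥-elim (u≢w (sym w≡u))
  ... | no _    = refl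

  sum-without : ∀ {n} (f : Fin n → ℕ) u → sum (tabulate f) ≡ f u + sum (tabulate (without u f))
  sum-without f zero    = refl
  sum-without f (suc u) = begin
    f zero + sum (tabulate (λ w → f (suc w)))
      ≡⟨ cong (f zero +_) (sum-without (λ w → f (suc w)) u) ⟩
    f zero + (f (suc u) + sum (tabulate (without u (λ w → f (suc w)))))
      ≡⟨ x∙yz≈y∙xz (f zero) (f (suc u)) _ ⟩
    f (suc u) + sum (tabulate (without (suc u) f))
      ∎
    where open ≡-Reasoning

  count-positive : ∀ {n} (f : Fin n → ℕ) (L : List (Fin n)) → Unique L → All (λ u → 1 ≤ f u) L →
                   length L ≤ sum (map f (allFin n))
  count-positive f L unique positive =
    subst (length L ≤_) (cong sum (sym (map-tabulate id f))) (count f L unique positive)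
    where
    count : ∀ {n} (f : Fin n → ℕ) L → Unique L → All (λ u → 1 ≤ f u) L → length L ≤ sum (tabulate f)
    count f []      _              _              = z≤n
    count f (u ∷ L) (u∉L ∷ unique) (1≤fu ∷ positive) = begin
      1 + length L                         ≤⟨ ℕP.+-mono-≤ 1≤fu (count (without u f) L unique positive′) ⟩
      f u + sum (tabulate (without u f))   ≡⟨ sym (sum-without f u) ⟩
      sum (tabulate f)                     ∎
      where
      open ℕP.≤-Reasoning
      positive′ : All (λ w → 1 ≤ without u f w) L
      positive′ = All.map (λ (u≢w , 1≤fw) → subst (1 ≤_) (sym (without-≢ f u≢w)) 1≤fw)
                          (All.zip (u∉L , positive))

  sum-map-+ : ∀ {A : Set} (f g : A → ℕ) xs → sum (map (λ x → f x + g x) xs) ≡ sum (map f xs) + sum (map g xs)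
  sum-map-+ f g []       = refl
  sum-map-+ f g (x ∷ xs) = trans (cong (f x + g x +_) (sum-map-+ f g xs)) (interchange (f x) (g x) _ _)

  not-xor-self : ∀ b → not (b xor b) ≡ true
  not-xor-self true  = refl
  not-xor-self false = refl

  module _ (part : Fin N → Bool) where
    side : Vertex → Bool
    side y = part (encode y)

    deg : Vertex → ℕ
    deg v = degInPart G part (encode v)

    Mate : Vertex → Vertex → Set
    Mate v y = Adj v y × side y ≡ side v

    private
      indicator : Vertex → Fin N → ℕ
      indicator v u = if Graph.adj G (encode v) u ∧ sameSide G part u (encode v) then 1 else 0

      indicator-mate : ∀ {v y} → Mate v y → 1 ≤ indicator v (encode y)
      indicator-mate {v} {y} (a , same) rewrite Adj⇒edge a | same | not-xor-self (side v) = s≤s z≤n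

    mates-bound : ∀ v L → Unique L → All (Mate v) L → length L ≤ deg v
    mates-bound v L unique mates =
      subst (_≤ deg v) (length-map encode L)
        (count-positive (indicator v) (map encode L) (Unique.map⁺ encode-injective unique)
                        (All.map⁺ (All.map indicator-mate mates)))

    mates-bound₂ : ∀ v w L → Unique L → All (λ y → Mate v y ⊎ Mate w y) L → length L ≤ deg v + deg w
    mates-bound₂ v w L unique mates =
      subst₂ _≤_ (length-map encode L) (sum-map-+ (indicator v) (indicator w) (allFin N))
        (count-positive (λ u → indicator v u + indicator w u) (map encode L)
                        (Unique.map⁺ encode-injective unique) (All.map⁺ (All.map one mates)))
      where
      one : ∀ {y} → Mate v y ⊎ Mate w y → 1 ≤ indicator v (encode y) + indicator w (encode y)
      one (inj₁ m) = ℕP.≤-trans (indicator-mate m) (ℕP.m≤m+n _ _)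
      one (inj₂ m) = ℕP.≤-trans (indicator-mate m) (ℕP.m≤n+m _ _)

  -- The argument of the theorem: in a (1,k)-partition, some hub lies on the
  -- second side; counting the mates of that hub and of a corner w_j on the
  -- second side gives M = 2k+1 ≤ k + k, so all corners lie on the first side,
  -- where their triangle gives a vertex two mates.
  module _ (part : Fin N → Bool)
           (proper : ∀ x → (part x ≡ true → degInPart G part x ≤ 1)
                         × (part x ≡ false → degInPart G part x ≤ k)) where

    one-mate : ∀ {v x y} → side part v ≡ true → Mate part v x → Mate part v y → x ≢ y → ⊥
    one-mate {v} {x} {y} first mx my x≢y =
      ℕP.<-irrefl refl (ℕP.≤-trans (mates-bound part v (x ∷ y ∷ []) ((x≢y ∷ []) ∷ [] ∷ []) (mx ∷ my ∷ []))
                                   (proj₁ (proper (encode v)) first))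

    no-first-triangle : ∀ {a b c} → Adj a b → Adj a c → b ≢ c →
                        side part a ≡ true → side part b ≡ true → side part c ≡ true → ⊥
    no-first-triangle ab ac b≢c sa sb sc = one-mate sa (ab , trans sb (sym sa)) (ac , trans sc (sym sa)) b≢c

    hub-on-second-side : Σ (Fin 3) λ g → side part (g , hub) ≡ false
    hub-on-second-side with side part (0F , hub) in s₀ | side part (1F , hub) in s₁ | side part (2F , hub) in s₂
    ... | false | _     | _     = 0F , s₀
    ... | true  | false | _     = 1F , s₁
    ... | true  | true  | false = 2F , s₂
    ... | true  | true  | true  = ⊥-elim (no-first-triangle (hub-hub λ ()) (hub-hub λ ()) (λ ()) s₀ s₁ s₂)

    -- For each i choose a_{ji} or b_{ji} if one of them is on the second
    -- side (a mate of the hub), and the link e_{ji} otherwise.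
    pick : Bool → Bool → Fin 3 → Fin M → Piece
    pick true  true  j i = link j i
    pick true  false j i = fanB j i
    pick false _     j i = fanA j i

    index : Piece → Fin M
    index (fanA _ i) = i
    index (fanB _ i) = i
    index (link _ i) = i
    index _          = zero

    index-pick : ∀ s t j i → index (pick s t j i) ≡ i
    index-pick true  true  j i = refl
    index-pick true  false j i = refl
    index-pick false _     j i = refl

    corner-on-first-side : ∀ {g} → side part (g , hub) ≡ false → ∀ j → side part (g , corner j) ≡ true
    corner-on-first-side {g} hub-second j with side part (g , corner j) in corner-side
    ... | true  = refl
    ... | false = ⊥-elim (ℕP.<-irrefl refl (begin-strict
        k + k                                       <⟨ ℕP.n<1+n (k + k) ⟩
        M                                           ≡⟨ sym (length-tabulate chosen) ⟩
        length (tabulate chosen)                    ≤⟨ mates-bound₂ part (g , hub) (g , corner j) (tabulate chosen)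
                                                         (Unique.tabulate⁺ chosen-injective) (All.tabulate⁺ mate) ⟩
        deg part (g , hub) + deg part (g , corner j) ≤⟨ ℕP.+-mono-≤ (proj₂ (proper _) hub-second)
                                                                    (proj₂ (proper _) corner-side) ⟩
        k + k                                       ∎))
      where
      open ℕP.≤-Reasoning
      chosen : Fin M → Vertex
      chosen i = g , pick (side part (g , fanA j i)) (side part (g , fanB j i)) j i

      chosen-injective : ∀ {i i′} → chosen i ≡ chosen i′ → i ≡ i′
      chosen-injective {i} {i′} e =
        trans (sym (index-pick (side part (g , fanA j i)) (side part (g , fanB j i)) j i))
              (trans (cong (λ v → index (proj₂ v)) e)
                     (index-pick (side part (g , fanA j i′)) (side part (g , fanB j i′)) j i′))

      mate : ∀ i → Mate part (g , hub) (chosen i) ⊎ Mate part (g , corner j) (chosen i)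
      mate i with side part (g , fanA j i) in a-side | side part (g , fanB j i) in b-side
      ... | false | _     = inj₁ (hub-fanA , trans a-side (sym hub-second))
      ... | true  | false = inj₁ (hub-fanB , trans b-side (sym hub-second))
      ... | true  | true  = inj₂ (corner-link , trans link-second (sym corner-side))
        where
        -- otherwise a_{ji} would have the two mates b_{ji} and e_{ji}
        link-second : side part (g , link j i) ≡ false
        link-second with side part (g , link j i) in e-side
        ... | false = refl
        ... | true  = ⊥-elim (one-mate a-side (fanA-fanB , trans b-side (sym a-side))
                                              (fanA-link , trans e-side (sym a-side)) λ ())

  -- The corners of the block with a hub on the second side form a triangle
  -- on the first side.
  not-colourable : ¬ Colorable G 1 k
  not-colourable (part , proper) with hub-on-second-side part proper
  ... | g , hub-second =
    no-first-triangle part proper (corner-corner {g} {0F} {1F} λ ()) (corner-corner {g} {0F} {2F} λ ()) (λ ())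
      (first 0F) (first 1F) (first 2F)
    where
    first : ∀ j → side part (g , corner j) ≡ true
    first = corner-on-first-side part proper hub-second

module Layout (m : ℕ) where

  M : ℕ
  M = suc m

  open Construction M
  open Geometry
  open import Data.Nat using (_+_; _*_; _≤_; _<_; z≤n; s≤s; _≤ᵇ_)
  import Data.Nat.Properties as ℕP
  open import Data.Nat.Tactic.RingSolver using (solve-∀)
  open import Data.Fin using (Fin; suc; toℕ; combine)
  open import Data.Fin.Patterns using (0F; 1F; 2F)
  open import Data.Fin.Properties using (toℕ<n; toℕ-injective; toℕ-combine; combine-injective)
  open import Data.Bool using (T)
  open import Data.Product using (_×_; _,_; proj₁; proj₂)
  open import Data.Empty using (⊥; ⊥-elim)
  open import Relation.Binary.PropositionalEquality
  open import Relation.Binary.Definitions using (tri<; tri≈; tri>)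

  lit : ∀ a b → {T (a ≤ᵇ b)} → a ≤ b
  lit a b {t} = ℕP.≤ᵇ⇒≤ a b t

  -- The pairs (j, i) are
  -- numbered by slot j i = M j + i < 3M; the triangle a b of slot s sits at
  -- height 2 at x = 2s+1, 2s+2, its link directly above a at height 3, and
  -- the corner w_j above the links of its column.  The hub lies below, at
  -- the right end of block 0 and at the left end of blocks 1 and 2, so that
  -- the hub triangle can be drawn underneath the blocks 0, 1, 2 placed from
  -- left to right.  Slots are kept abstract: only the three properties
  -- below are used.
  abstract
    slot : Fin 3 → Fin M → ℕ
    slot j i = toℕ (combine j i)

    slot-injective : ∀ {j i j′ i′} → slot j i ≡ slot j′ i′ → j ≡ j′ × i ≡ i′
    slot-injective {j} {i} {j′} {i′} e = combine-injective j i j′ i′ (toℕ-injective e)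

    slot-lower : ∀ j i → M * toℕ j ≤ slot j i
    slot-lower j i = subst (M * toℕ j ≤_) (sym (toℕ-combine j i)) (ℕP.m≤m+n _ _)

    slot-upper : ∀ j i → suc (slot j i) ≤ M * suc (toℕ j)
    slot-upper j i = begin
      suc (slot j i)            ≡⟨ cong suc (toℕ-combine j i) ⟩
      suc (M * toℕ j + toℕ i)   ≡⟨ ℕP.+-suc (M * toℕ j) (toℕ i) ⟨
      M * toℕ j + suc (toℕ i)   ≤⟨ ℕP.+-monoʳ-≤ (M * toℕ j) (toℕ<n i) ⟩
      M * toℕ j + M             ≡⟨ ℕP.+-comm (M * toℕ j) M ⟩
      M + M * toℕ j             ≡⟨ ℕP.*-suc M (toℕ j) ⟨
      M * suc (toℕ j)           ∎
      where open ℕP.≤-Reasoning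

  width : ℕ
  width = suc (2 * (3 * M))

  hubX : Fin 3 → ℕ
  hubX 0F      = width
  hubX (suc _) = 0

  localX : Fin 3 → Piece → ℕ
  localX g       hub         = hubX g
  localX _       (corner 0F) = 2 * M
  localX _       (corner 1F) = suc (2 * M)
  localX _       (corner 2F) = suc (2 * (2 * M))
  localX _       (fanA j i)  = suc (2 * slot j i)
  localX _       (fanB j i)  = suc (suc (2 * slot j i))
  localX _       (link j i)  = suc (2 * slot j i)

  hubHeight : Fin 3 → ℕ
  hubHeight 1F = 1
  hubHeight _  = 0

  height : Fin 3 → Piece → ℕ
  height g hub         = hubHeight g
  height _ (corner 0F) = 5
  height _ (corner 1F) = 4
  height _ (corner 2F) = 5
  height _ (fanA _ _)  = 2
  height _ (fanB _ _)  = 2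
  height _ (link _ _)  = 3

  offset : Fin 3 → ℕ
  offset g = toℕ g * suc width

  pos : Vertex → LatticePoint
  pos (g , u) = offset g + localX g u , height g u

  open Segments pos public

  xOf yOf : Vertex → ℕ
  xOf v = coord xAxis (pos v)
  yOf v = coord yAxis (pos v)

  hubHeight≤1 : ∀ g → hubHeight g ≤ 1
  hubHeight≤1 0F = z≤n
  hubHeight≤1 1F = s≤s z≤n
  hubHeight≤1 2F = z≤n

  -- Columns.  The links and fanA's of column j and the corner w_j have
  -- x-coordinates in [columnStart j, columnEnd j]; the columns are disjoint.
  columnStart columnEnd : Fin 3 → ℕ
  columnStart 0F = 0
  columnStart 1F = suc (2 * M)
  columnStart 2F = suc (2 * (2 * M))
  columnEnd 0F = 2 * M
  columnEnd 1F = 2 * (2 * M)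
  columnEnd 2F = width

  private
    twice-slot-lower : ∀ j i → suc (2 * (M * toℕ j)) ≤ suc (2 * slot j i)
    twice-slot-lower j i = s≤s (ℕP.*-monoʳ-≤ 2 (slot-lower j i))

    twice-slot-upper : ∀ j i → suc (suc (2 * slot j i)) ≤ 2 * (M * suc (toℕ j))
    twice-slot-upper j i = subst (_≤ 2 * (M * suc (toℕ j))) (ℕP.*-suc 2 (slot j i))
                                 (ℕP.*-monoʳ-≤ 2 (slot-upper j i))

  link-in-column : ∀ j i → columnStart j ≤ suc (2 * slot j i) × suc (2 * slot j i) ≤ columnEnd j
  link-in-column 0F i =
    z≤n ,
    ℕP.≤-trans (ℕP.n≤1+n _) (subst (λ n → suc (suc (2 * slot 0F i)) ≤ 2 * n) (ℕP.*-identityʳ M) (twice-slot-upper 0F i))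
  link-in-column 1F i =
    subst (λ n → suc (2 * n) ≤ suc (2 * slot 1F i)) (ℕP.*-identityʳ M) (twice-slot-lower 1F i) ,
    ℕP.≤-trans (ℕP.n≤1+n _) (subst (λ n → suc (suc (2 * slot 1F i)) ≤ 2 * n) (ℕP.*-comm M 2) (twice-slot-upper 1F i))
  link-in-column 2F i =
    subst (λ n → suc (2 * n) ≤ suc (2 * slot 2F i)) (ℕP.*-comm M 2) (twice-slot-lower 2F i) ,
    ℕP.≤-trans (ℕP.n≤1+n _) (ℕP.≤-trans (subst (λ n → suc (suc (2 * slot 2F i)) ≤ 2 * n) (ℕP.*-comm M 3) (twice-slot-upper 2F i))
                                         (ℕP.n≤1+n _))

  private
    2M<4M : suc (2 * M) ≤ 2 * (2 * M)
    2M<4M = subst (suc (2 * M) ≤_) (equation m) (ℕP.m≤m+n (suc (2 * M)) (suc (2 * m)))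
      where
      equation : ∀ m → suc (2 * suc m) + suc (2 * m) ≡ 2 * (2 * suc m)
      equation = solve-∀

    4M<width : suc (2 * (2 * M)) ≤ width
    4M<width = s≤s (ℕP.*-monoʳ-≤ 2 (ℕP.*-monoˡ-≤ M (lit 2 3)))

  corner-in-column : ∀ g j → columnStart j ≤ localX g (corner j) × localX g (corner j) ≤ columnEnd j
  corner-in-column g 0F = z≤n , ℕP.≤-refl
  corner-in-column g 1F = ℕP.≤-refl , 2M<4M
  corner-in-column g 2F = ℕP.≤-refl , 4M<width

  columns-ordered : ∀ {j j′} → toℕ j < toℕ j′ → suc (columnEnd j) ≤ columnStart j′
  columns-ordered {0F} {1F} _ = ℕP.≤-refl
  columns-ordered {0F} {2F} _ = s≤s (ℕP.≤-trans (ℕP.n≤1+n _) 2M<4M)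
  columns-ordered {1F} {2F} _ = ℕP.≤-refl
  columns-ordered {1F} {0F} ()
  columns-ordered {2F} {0F} ()
  columns-ordered {0F} {0F} ()
  columns-ordered {1F} {1F} (s≤s ())
  columns-ordered {2F} {1F} (s≤s ())
  columns-ordered {2F} {2F} (s≤s (s≤s ()))

  columnEnd≤width : ∀ j → columnEnd j ≤ width
  columnEnd≤width 0F = ℕP.≤-trans (ℕP.n≤1+n _) (ℕP.≤-trans 2M<4M (ℕP.≤-trans (ℕP.n≤1+n _) 4M<width))
  columnEnd≤width 1F = ℕP.≤-trans (ℕP.n≤1+n _) 4M<width
  columnEnd≤width 2F = ℕP.≤-refl

  localX≤width : ∀ g u → localX g u ≤ width
  localX≤width 0F      hub        = ℕP.≤-refl
  localX≤width (suc _) hub        = z≤n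
  localX≤width g       (corner j) = ℕP.≤-trans (proj₂ (corner-in-column g j)) (columnEnd≤width j)
  localX≤width g       (fanA j i) = ℕP.≤-trans (proj₂ (link-in-column j i)) (columnEnd≤width j)
  localX≤width g       (link j i) = ℕP.≤-trans (proj₂ (link-in-column j i)) (columnEnd≤width j)
  localX≤width g       (fanB j i) = ℕP.≤-trans (twice-slot-upper j i) (ℕP.≤-trans
    (ℕP.*-monoʳ-≤ 2 (ℕP.*-monoʳ-≤ M (toℕ<n j))) (subst (λ n → 2 * n ≤ width) (ℕP.*-comm 3 M) (ℕP.n≤1+n _)))

  blocks-ordered : ∀ {g g′} → toℕ g < toℕ g′ → offset g + width < offset g′
  blocks-ordered {g} {g′} g<g′ = begin-strict
    toℕ g * suc width + width       <⟨ ℕP.+-monoʳ-< (toℕ g * suc width) (ℕP.n<1+n width) ⟩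
    toℕ g * suc width + suc width   ≡⟨ ℕP.+-comm (toℕ g * suc width) (suc width) ⟩
    suc (toℕ g) * suc width         ≤⟨ ℕP.*-monoˡ-≤ (suc width) g<g′ ⟩
    toℕ g′ * suc width              ∎
    where open ℕP.≤-Reasoning

  same-block : ∀ {g g′ a a′} → offset g + a ≡ offset g′ + a′ → a ≤ width → a′ ≤ width → g ≡ g′
  same-block {g} {g′} {a} {a′} e a≤w a′≤w with ℕP.<-cmp (toℕ g) (toℕ g′)
  ... | tri≈ _ g≡g′ _ = toℕ-injective g≡g′
  ... | tri< g<g′ _ _ = ⊥-elim (ℕP.<-irrefl e (ℕP.≤-<-trans (ℕP.+-monoʳ-≤ (offset g) a≤w)
                                 (ℕP.<-≤-trans (blocks-ordered g<g′) (ℕP.m≤m+n _ a′))))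
  ... | tri> _ _ g′<g = ⊥-elim (ℕP.<-irrefl (sym e) (ℕP.≤-<-trans (ℕP.+-monoʳ-≤ (offset g′) a′≤w)
                                 (ℕP.<-≤-trans (blocks-ordered g′<g) (ℕP.m≤m+n _ a))))

  private
    hub-alone : ∀ g u → height g u ≤ 1 → u ≡ hub
    hub-alone g hub         _        = refl
    hub-alone g (corner 0F) (s≤s ())
    hub-alone g (corner 1F) (s≤s ())
    hub-alone g (corner 2F) (s≤s ())
    hub-alone g (fanA _ _)  (s≤s ())
    hub-alone g (fanB _ _)  (s≤s ())
    hub-alone g (link _ _)  (s≤s ())

    corner-high : ∀ g j → 4 ≤ height g (corner j)
    corner-high g 0F = lit 4 5
    corner-high g 1F = lit 4 4
    corner-high g 2F = lit 4 5

    not-corner : ∀ {g j n} → height g (corner j) ≡ n → n ≤ 3 → ⊥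
    not-corner {g} {j} refl n≤3 = ℕP.<-irrefl refl (ℕP.<-≤-trans (s≤s n≤3) (corner-high g j))

    by-slot : ∀ (f : Fin 3 → Fin M → Piece) {j i j′ i′} → 2 * slot j i ≡ 2 * slot j′ i′ → f j i ≡ f j′ i′
    by-slot f {j} {i} {j′} {i′} e with slot-injective (ℕP.*-cancelˡ-≡ (slot j i) (slot j′ i′) 2 e)
    ... | refl , refl = refl

  local-injective : ∀ g u u′ → localX g u ≡ localX g u′ → height g u ≡ height g u′ → u ≡ u′
  local-injective g hub u′ _ h = sym (hub-alone g u′ (subst (_≤ 1) h (hubHeight≤1 g)))
  local-injective g u hub _ h = hub-alone g u (subst (_≤ 1) (sym h) (hubHeight≤1 g))
  local-injective g (fanA _ _) (fanA _ _) x _ = by-slot fanA (ℕP.suc-injective x)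
  local-injective g (fanB _ _) (fanB _ _) x _ = by-slot fanB (ℕP.suc-injective (ℕP.suc-injective x))
  local-injective g (link _ _) (link _ _) x _ = by-slot link (ℕP.suc-injective x)
  local-injective g (fanA j i) (fanB j′ i′) x _ = ⊥-elim (ℕP.even≢odd (slot j i) (slot j′ i′) (ℕP.suc-injective x))
  local-injective g (fanB j i) (fanA j′ i′) x _ = ⊥-elim (ℕP.even≢odd (slot j′ i′) (slot j i) (ℕP.suc-injective (sym x)))
  local-injective g (fanA _ _) (link _ _) _ ()
  local-injective g (fanB _ _) (link _ _) _ ()
  local-injective g (link _ _) (fanA _ _) _ ()
  local-injective g (link _ _) (fanB _ _) _ ()
  local-injective g (corner j) (fanA _ _) _ h = ⊥-elim (not-corner {g} {j} h (lit 2 3))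
  local-injective g (corner j) (fanB _ _) _ h = ⊥-elim (not-corner {g} {j} h (lit 2 3))
  local-injective g (corner j) (link _ _) _ h = ⊥-elim (not-corner {g} {j} h (lit 3 3))
  local-injective g (fanA _ _) (corner j) _ h = ⊥-elim (not-corner {g} {j} (sym h) (lit 2 3))
  local-injective g (fanB _ _) (corner j) _ h = ⊥-elim (not-corner {g} {j} (sym h) (lit 2 3))
  local-injective g (link _ _) (corner j) _ h = ⊥-elim (not-corner {g} {j} (sym h) (lit 3 3))
  local-injective g (corner 0F) (corner 0F) _ _ = refl
  local-injective g (corner 1F) (corner 1F) _ _ = refl
  local-injective g (corner 2F) (corner 2F) _ _ = refl
  local-injective g (corner 0F) (corner 1F) _ ()
  local-injective g (corner 1F) (corner 0F) _ ()
  local-injective g (corner 1F) (corner 2F) _ ()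
  local-injective g (corner 2F) (corner 1F) _ ()
  local-injective g (corner 0F) (corner 2F) x _ = ⊥-elim (ℕP.even≢odd M (2 * M) x)
  local-injective g (corner 2F) (corner 0F) x _ = ⊥-elim (ℕP.even≢odd M (2 * M) (sym x))

  pos-injective : ∀ {v v′} → pos v ≡ pos v′ → v ≡ v′
  pos-injective {g , u} {g′ , u′} e
    with same-block {g} {g′} (cong proj₁ e) (localX≤width g u) (localX≤width g′ u′)
  ... | refl = cong (g ,_) (local-injective g u u′ (ℕP.+-cancelˡ-≡ (offset g) _ _ (cong proj₁ e)) (cong proj₂ e))

module BlockEdges (m : ℕ) where

  open Construction (suc m)
  open Geometry
  open Layout m
  open import Defs using (Point)
  open import Data.Rational using () renaming (_≤_ to _≤ℚ_)
  open import Data.Nat using (_+_; _*_; _≤_; _<_; z≤n; s≤s; _≤ᵇ_)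
  import Data.Nat.Properties as ℕP
  open import Data.Fin using (Fin; zero; suc; toℕ; _≟_)
  open import Data.Fin.Patterns using (0F; 1F; 2F)
  open import Data.Fin.Properties using (toℕ-injective)
  open import Data.Bool using (T)
  open import Data.Product using (Σ; _×_; _,_; proj₁; proj₂)
  open import Data.Sum using (_⊎_; inj₁; inj₂)
  open import Data.Empty using (⊥; ⊥-elim)
  open import Relation.Binary.PropositionalEquality
  open import Relation.Binary.Definitions using (tri<; tri≈; tri>)
  open import Relation.Nullary using (yes; no; Dec)
  open import Relation.Nullary.Decidable using (map′)
  open import Data.Product.Properties using (≡-dec)

  Ends : Set
  Ends = Vertex × Vertex

  OnEdge : Point → Ends → Set
  OnEdge z (u , v) = On z u v

  Endpoint : Vertex → Ends → Set
  Endpoint w (u , v) = w ≡ u ⊎ w ≡ v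

  Meet : Ends → Ends → Point → Set
  Meet (u , v) (x , y) z =
    ((u ≡ x × v ≡ y) ⊎ (u ≡ y × v ≡ x))
    ⊎ Σ Vertex λ w → Endpoint w (u , v) × Endpoint w (x , y) × (z ≡ ⟦ pos w ⟧)

  same : ∀ {e z} → Meet e e z
  same = inj₁ (inj₁ (refl , refl))

  at : ∀ {e e′ z} w → Endpoint w e → Endpoint w e′ → z ≡ ⟦ pos w ⟧ → Meet e e′ z
  at w w∈e w∈e′ z≡w = inj₂ (w , w∈e , w∈e′ , z≡w)

  at-both : ∀ {e e′ z} w w′ → Endpoint w e → Endpoint w′ e′ → z ≡ ⟦ pos w ⟧ → z ≡ ⟦ pos w′ ⟧ → Meet e e′ z
  at-both {e′ = e′} w w′ w∈e w′∈e′ z≡w z≡w′ =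
    at w w∈e (subst (λ v → Endpoint v e′) (sym (pos-injective (⟦⟧-injective (trans (sym z≡w) z≡w′)))) w′∈e′) z≡w

  first : ∀ {u v} → Endpoint u (u , v)
  first = inj₁ refl

  second : ∀ {u v} → Endpoint v (u , v)
  second = inj₂ refl

  Meet-swap : ∀ {e e′ z} → Meet e′ e z → Meet e e′ z
  Meet-swap (inj₁ (inj₁ (refl , refl))) = same
  Meet-swap (inj₁ (inj₂ (refl , refl))) = inj₁ (inj₂ (refl , refl))
  Meet-swap (inj₂ (w , w∈e′ , w∈e , z≡w)) = at w w∈e w∈e′ z≡w

  Meet-reverse : ∀ {e u v z} → Meet e (v , u) z → Meet e (u , v) z
  Meet-reverse (inj₁ (inj₁ (refl , refl))) = inj₁ (inj₂ (refl , refl))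
  Meet-reverse (inj₁ (inj₂ (refl , refl))) = same
  Meet-reverse (inj₂ (w , w∈e , inj₁ w≡v , z≡w)) = at w w∈e (inj₂ w≡v) z≡w
  Meet-reverse (inj₂ (w , w∈e , inj₂ w≡u , z≡w)) = at w w∈e (inj₁ w≡u) z≡w

  coord-at : ∀ {z w} a → z ≡ ⟦ pos w ⟧ → coord a z ≡ ι (coord a (pos w))
  coord-at xAxis refl = refl
  coord-at yAxis refl = refl

  vertex-between : ∀ {z u v w} → On z u v → z ≡ ⟦ pos w ⟧ → xOf u ≤ xOf v → xOf u ≤ xOf w × xOf w ≤ xOf v
  vertex-between {z} {u} {v} {w} o z≡w u≤v =
    ι-cancel-≤ (subst (ι (xOf u) ≤ℚ_) (coord-at {w = w} xAxis z≡w) (bounded-below o xAxis ℕP.≤-refl u≤v)) ,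
    ι-cancel-≤ (subst (_≤ℚ ι (xOf v)) (coord-at {w = w} xAxis z≡w) (bounded-above o xAxis u≤v ℕP.≤-refl))

  _≟ᵥ_ : ∀ (x y : Vertex) → Dec (x ≡ y)
  x ≟ᵥ y = map′ pos-injective (cong pos) (≡-dec ℕP._≟_ ℕP._≟_ (pos x) (pos y))

  on-horizontal : ∀ {z u v} → On z u v → yOf v ≡ yOf u → coord yAxis z ≡ ι (yOf u)
  on-horizontal o vy≡uy =
    meet-on-line o o yAxis ℕP.≤-refl (ℕP.≤-reflexive vy≡uy) ℕP.≤-refl (ℕP.≤-reflexive (sym vy≡uy))

  on-unit-segment : ∀ {z u v w} → On z u v → z ≡ ⟦ pos w ⟧ →
                    yOf v ≡ yOf u → xOf v ≡ suc (xOf u) → Endpoint w (u , v)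
  on-unit-segment {z} {u} {v} {w} o z≡w vy≡uy vx≡1+ux = end (ℕP.m≤n⇒m<n∨m≡n u≤w)
    where
    wy≡uy : yOf w ≡ yOf u
    wy≡uy = ι-injective (trans (sym (coord-at {w = w} yAxis z≡w)) (on-horizontal o vy≡uy))
    between = vertex-between {w = w} o z≡w (subst (xOf u ≤_) (sym vx≡1+ux) (ℕP.n≤1+n _))
    u≤w = proj₁ between
    end : xOf u < xOf w ⊎ xOf u ≡ xOf w → Endpoint w (u , v)
    end (inj₂ u≡w) = inj₁ (pos-injective (cong₂ _,_ (sym u≡w) wy≡uy))
    end (inj₁ u<w) = inj₂ (pos-injective (cong₂ _,_
      (ℕP.≤-antisym (proj₂ between) (subst (_≤ xOf w) (sym vx≡1+ux) u<w)) (trans wy≡uy (sym vy≡uy))))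

  data BlockEdge : Set where
    hubA hubB fanAB fanLink linkCorner : Fin 3 → Fin M → BlockEdge
    corner01 corner12 corner02 : BlockEdge

  pieces : BlockEdge → Piece × Piece
  pieces (hubA j i)       = hub , fanA j i
  pieces (hubB j i)       = hub , fanB j i
  pieces (fanAB j i)      = fanA j i , fanB j i
  pieces (fanLink j i)    = fanA j i , link j i
  pieces (linkCorner j i) = link j i , corner j
  pieces corner01         = corner 0F , corner 1F
  pieces corner12         = corner 1F , corner 2F
  pieces corner02         = corner 0F , corner 2F

  ends : Fin 3 → BlockEdge → Ends
  ends g l = (g , proj₁ (pieces l)) , (g , proj₂ (pieces l))

  -- Each block edge lies in a horizontal band [bottom, top]; edges with
  -- disjoint bands do not meet.
  bottom top : BlockEdge → ℕ
  bottom (hubA _ _)       = 0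
  bottom (hubB _ _)       = 0
  bottom (fanAB _ _)      = 2
  bottom (fanLink _ _)    = 2
  bottom (linkCorner _ _) = 3
  bottom corner01         = 4
  bottom corner12         = 4
  bottom corner02         = 5
  top (hubA _ _)          = 2
  top (hubB _ _)          = 2
  top (fanAB _ _)         = 2
  top (fanLink _ _)       = 3
  top (linkCorner _ _)    = 5
  top corner01            = 5
  top corner12            = 5
  top corner02            = 5

  corner-height : ∀ g j → 4 ≤ height g (corner j) × height g (corner j) ≤ 5
  corner-height g 0F = lit 4 5 , lit 5 5
  corner-height g 1F = lit 4 4 , lit 4 5
  corner-height g 2F = lit 4 5 , lit 5 5

  hub-height : ∀ g → hubHeight g ≤ 2
  hub-height g = ℕP.≤-trans (hubHeight≤1 g) (lit 1 2)

  in-band : ∀ g l → let (u , v) = ends g l in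
            (bottom l ≤ yOf u × yOf u ≤ top l) × (bottom l ≤ yOf v × yOf v ≤ top l)
  in-band g (hubA j i)       = (z≤n , hub-height g) , (lit 0 2 , lit 2 2)
  in-band g (hubB j i)       = (z≤n , hub-height g) , (lit 0 2 , lit 2 2)
  in-band g (fanAB j i)      = (lit 2 2 , lit 2 2) , (lit 2 2 , lit 2 2)
  in-band g (fanLink j i)    = (lit 2 2 , lit 2 3) , (lit 2 3 , lit 3 3)
  in-band g (linkCorner j i) = (lit 3 3 , lit 3 5) , (ℕP.≤-trans (lit 3 4) (proj₁ (corner-height g j)) ,
                                                      proj₂ (corner-height g j))
  in-band g corner01         = (lit 4 5 , lit 5 5) , (lit 4 4 , lit 4 5)
  in-band g corner12         = (lit 4 4 , lit 4 5) , (lit 4 5 , lit 5 5)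
  in-band g corner02         = (lit 5 5 , lit 5 5) , (lit 5 5 , lit 5 5)

  apart-by-height : ∀ {g z} l l′ → {T (suc (top l) ≤ᵇ bottom l′)} →
                    OnEdge z (ends g l) → OnEdge z (ends g l′) → ⊥
  apart-by-height {g} l l′ {gap} o o′ =
    separated o o′ yAxis (proj₂ (proj₁ (in-band g l))) (proj₂ (proj₂ (in-band g l)))
      (ℕP.≤-trans (lit (suc (top l)) (bottom l′) {gap}) (proj₁ (proj₁ (in-band g l′))))
      (ℕP.≤-trans (lit (suc (top l)) (bottom l′) {gap}) (proj₁ (proj₂ (in-band g l′))))

  module InBlock (g : Fin 3) where
    H : Vertex
    H = g , hub

    A B E : Fin 3 → Fin M → Vertex
    A j i = g , fanA j i
    B j i = g , fanB j i
    E j i = g , link j i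

    W : Fin 3 → Vertex
    W j = g , corner j

    private
      hub-below : hubHeight g ≢ 2
      hub-below e = ℕP.<-irrefl e (ℕP.≤-<-trans (hubHeight≤1 g) (lit 2 2))

      corner-above : ∀ j → height g (corner j) ≢ 3
      corner-above j e = ℕP.<-irrefl (sym e) (ℕP.<-≤-trans (lit 4 4) (proj₁ (corner-height g j)))

      shift : ∀ {a b} → a ≤ b → offset g + a ≤ offset g + b
      shift = ℕP.+-monoʳ-≤ (offset g)

      shift-< : ∀ {a b} → a < b → offset g + a < offset g + b
      shift-< = ℕP.+-monoʳ-< (offset g)

      base-unit : ∀ j i → xOf (B j i) ≡ suc (xOf (A j i))
      base-unit j i = ℕP.+-suc (offset g) (suc (2 * slot j i))

      slots-apart : ∀ {s s′} → s < s′ → suc (suc (suc (2 * s))) ≤ suc (2 * s′)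
      slots-apart {s} {s′} s<s′ = s≤s (subst (_≤ 2 * s′) (ℕP.*-suc 2 s) (ℕP.*-monoʳ-≤ 2 s<s′))

      ladder-in-column : ∀ j i → (offset g + columnStart j ≤ xOf (E j i) × xOf (E j i) ≤ offset g + columnEnd j)
                                × (offset g + columnStart j ≤ xOf (W j) × xOf (W j) ≤ offset g + columnEnd j)
      ladder-in-column j i = (shift (proj₁ (link-in-column j i)) , shift (proj₂ (link-in-column j i))) ,
                             (shift (proj₁ (corner-in-column g j)) , shift (proj₂ (corner-in-column g j)))

      columns-apart : ∀ {j j′} → toℕ j < toℕ j′ → offset g + columnEnd j < offset g + columnStart j′
      columns-apart j<j′ = shift-< (columns-ordered j<j′)

      corners-ordered : ∀ {j j′} → toℕ j < toℕ j′ → xOf (W j) < xOf (W j′)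
      corners-ordered {j} {j′} j<j′ = ℕP.≤-<-trans (proj₂ (proj₂ (ladder-in-column j zero)))
        (ℕP.<-≤-trans (columns-apart j<j′) (proj₁ (proj₂ (ladder-in-column j′ zero))))

      spoke-tip : ∀ {z x} → yOf x ≡ 2 → On z H x → coord yAxis z ≡ ι 2 → z ≡ ⟦ pos x ⟧
      spoke-tip x2 o zy = end-by-coord o yAxis (trans zy (cong ι (sym x2))) (λ e → hub-below (trans e x2))

    module _ {z : Point} where
      spokes : ∀ {x y} → yOf x ≡ 2 → yOf y ≡ 2 → On z H x → On z H y → Meet (H , x) (H , y) z
      spokes {x} {y} x2 y2 o o′ with x ≟ᵥ y
      ... | yes refl = same
      ... | no x≢y = at H first first
        (fan o o′ (trans x2 (sym y2)) (λ e → hub-below (trans (sym e) x2)) (λ e → x≢y (pos-injective e)))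

      spoke-base : ∀ {x j i} → yOf x ≡ 2 → On z H x → On z (A j i) (B j i) → Meet (H , x) (A j i , B j i) z
      spoke-base {x} {j} {i} x2 o o′ = at x second (on-unit-segment {w = x} o′ z≡x refl (base-unit j i)) z≡x
        where
        z≡x = spoke-tip x2 o (meet-on-line o o′ yAxis (hub-height g) (ℕP.≤-reflexive x2) (lit 2 2) (lit 2 2))

      spoke-riser : ∀ {x j i} → yOf x ≡ 2 → On z H x → On z (A j i) (E j i) → Meet (H , x) (A j i , E j i) z
      spoke-riser {x} {j} {i} x2 o o′ = at-both x (A j i) second first (spoke-tip x2 o zy) (start-by-coord o′ yAxis zy λ ())
        where
        zy = meet-on-line o o′ yAxis (hub-height g) (ℕP.≤-reflexive x2) (lit 2 2) (lit 2 3)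

      -- distinct bases, and distinct risers, lie in disjoint vertical strips
      bases : ∀ {j i j′ i′} → On z (A j i) (B j i) → On z (A j′ i′) (B j′ i′) → Meet (A j i , B j i) (A j′ i′ , B j′ i′) z
      bases {j} {i} {j′} {i′} o o′ with ℕP.<-cmp (slot j i) (slot j′ i′)
      ... | tri≈ _ s≡s′ _ with slot-injective s≡s′
      ...   | refl , refl = same
      bases o o′ | tri< s<s′ _ _ = ⊥-elim (separated o o′ xAxis (shift (ℕP.n≤1+n _)) ℕP.≤-refl
        (shift-< (slots-apart s<s′)) (shift-< (ℕP.≤-trans (slots-apart s<s′) (ℕP.n≤1+n _))))
      bases o o′ | tri> _ _ s′<s = ⊥-elim (separated o′ o xAxis (shift (ℕP.n≤1+n _)) ℕP.≤-refl
        (shift-< (slots-apart s′<s)) (shift-< (ℕP.≤-trans (slots-apart s′<s) (ℕP.n≤1+n _))))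

      risers : ∀ {j i j′ i′} → On z (A j i) (E j i) → On z (A j′ i′) (E j′ i′) → Meet (A j i , E j i) (A j′ i′ , E j′ i′) z
      risers {j} {i} {j′} {i′} o o′ with ℕP.<-cmp (slot j i) (slot j′ i′)
      ... | tri≈ _ s≡s′ _ with slot-injective s≡s′
      ...   | refl , refl = same
      risers o o′ | tri< s<s′ _ _ =
        ⊥-elim (separated o o′ xAxis ℕP.≤-refl ℕP.≤-refl (gap s<s′) (gap s<s′))
        where gap = λ s<s′ → shift-< (ℕP.≤-trans (ℕP.n≤1+n _) (slots-apart s<s′))
      risers o o′ | tri> _ _ s′<s =
        ⊥-elim (separated o′ o xAxis ℕP.≤-refl ℕP.≤-refl (gap s′<s) (gap s′<s))
        where gap = λ s′<s → shift-< (ℕP.≤-trans (ℕP.n≤1+n _) (slots-apart s′<s))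

      base-riser : ∀ {j i j′ i′} → On z (A j i) (B j i) → On z (A j′ i′) (E j′ i′) →
                   Meet (A j i , B j i) (A j′ i′ , E j′ i′) z
      base-riser {j} {i} {j′} {i′} o o′ = at (A j′ i′) (on-unit-segment {w = A j′ i′} o z≡a refl (base-unit j i)) first z≡a
        where
        z≡a = start-by-coord o′ yAxis (meet-on-line o o′ yAxis (lit 2 2) (lit 2 2) (lit 2 2) (lit 2 3)) λ ()

      riser-ladder : ∀ {j i j′ i′} → On z (A j i) (E j i) → On z (E j′ i′) (W j′) →
                     Meet (A j i , E j i) (E j′ i′ , W j′) z
      riser-ladder {j} {i} {j′} {i′} o o′ =
        at-both (E j i) (E j′ i′) second first (end-by-coord o yAxis zy λ ()) (start-by-coord o′ yAxis zy (corner-above j′))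
        where
        zy = meet-on-line o o′ yAxis (lit 2 3) (lit 3 3) (lit 3 3) (ℕP.≤-trans (lit 3 4) (proj₁ (corner-height g j′)))

      -- ladder edges of one column fan out from the corner; columns are apart
      ladders : ∀ {j i j′ i′} → On z (E j i) (W j) → On z (E j′ i′) (W j′) → Meet (E j i , W j) (E j′ i′ , W j′) z
      ladders {j} {i} {j′} {i′} o o′ with ℕP.<-cmp (toℕ j) (toℕ j′)
      ... | tri≈ _ j≡j′ _ with toℕ-injective j≡j′
      ...   | refl with i ≟ i′
      ...     | yes refl = same
      ...     | no i≢i′ = at (W j) second second (fan (On-sym o) (On-sym o′) refl (λ e → corner-above j (sym e))
                                                      (λ e → i≢i′ (link-index (pos-injective e))))
        where
        link-index : ∀ {a b} → E j a ≡ E j b → a ≡ b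
        link-index refl = refl
      ladders {j} {i} {j′} {i′} o o′ | tri< j<j′ _ _ = ⊥-elim (separated o o′ xAxis
        (proj₂ (proj₁ (ladder-in-column j i))) (proj₂ (proj₂ (ladder-in-column j i)))
        (ℕP.<-≤-trans (columns-apart j<j′) (proj₁ (proj₁ (ladder-in-column j′ i′))))
        (ℕP.<-≤-trans (columns-apart j<j′) (proj₁ (proj₂ (ladder-in-column j′ i′)))))
      ladders {j} {i} {j′} {i′} o o′ | tri> _ _ j′<j = ⊥-elim (separated o′ o xAxis
        (proj₂ (proj₁ (ladder-in-column j′ i′))) (proj₂ (proj₂ (ladder-in-column j′ i′)))
        (ℕP.<-≤-trans (columns-apart j′<j) (proj₁ (proj₁ (ladder-in-column j i))))
        (ℕP.<-≤-trans (columns-apart j′<j) (proj₁ (proj₂ (ladder-in-column j i)))))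

      ladder₀-side01 : ∀ {i} → On z (E 0F i) (W 0F) → On z (W 0F) (W 1F) → Meet (E 0F i , W 0F) (W 0F , W 1F) z
      ladder₀-side01 {i} o o′ = at (W 0F) second first (start-by-coord o′ xAxis
        (meet-on-line o o′ xAxis (proj₂ (proj₁ (ladder-in-column 0F i))) ℕP.≤-refl ℕP.≤-refl (ℕP.<⇒≤ w₀<w₁))
        (ℕP.>⇒≢ w₀<w₁))
        where w₀<w₁ = corners-ordered {0F} {1F} (s≤s z≤n)

      ladder₀-side12 : ∀ {i} → On z (E 0F i) (W 0F) → On z (W 1F) (W 2F) → Meet (E 0F i , W 0F) (W 1F , W 2F) z
      ladder₀-side12 {i} o o′ = ⊥-elim (separated o o′ xAxis (proj₂ (proj₁ (ladder-in-column 0F i))) ℕP.≤-refl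
        (corners-ordered {0F} {1F} (s≤s z≤n)) (corners-ordered {0F} {2F} (s≤s z≤n)))

      ladder₀-side02 : ∀ {i} → On z (E 0F i) (W 0F) → On z (W 0F) (W 2F) → Meet (E 0F i , W 0F) (W 0F , W 2F) z
      ladder₀-side02 {i} o o′ = at (W 0F) second first (start-by-coord o′ xAxis
        (meet-on-line o o′ xAxis (proj₂ (proj₁ (ladder-in-column 0F i))) ℕP.≤-refl ℕP.≤-refl (ℕP.<⇒≤ w₀<w₂))
        (ℕP.>⇒≢ w₀<w₂))
        where w₀<w₂ = corners-ordered {0F} {2F} (s≤s z≤n)

      ladder₁-side01 : ∀ {i} → On z (E 1F i) (W 1F) → On z (W 0F) (W 1F) → Meet (E 1F i , W 1F) (W 0F , W 1F) z
      ladder₁-side01 o o′ = at (W 1F) second second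
        (end-by-coord o′ yAxis (meet-on-line o o′ yAxis (lit 3 4) (lit 4 4) (lit 4 5) (lit 4 4)) λ ())

      ladder₁-side12 : ∀ {i} → On z (E 1F i) (W 1F) → On z (W 1F) (W 2F) → Meet (E 1F i , W 1F) (W 1F , W 2F) z
      ladder₁-side12 o o′ = at (W 1F) second first
        (start-by-coord o′ yAxis (meet-on-line o o′ yAxis (lit 3 4) (lit 4 4) (lit 4 4) (lit 4 5)) λ ())

      ladder₁-side02 : ∀ {i} → On z (E 1F i) (W 1F) → On z (W 0F) (W 2F) → Meet (E 1F i , W 1F) (W 0F , W 2F) z
      ladder₁-side02 o o′ = ⊥-elim (separated o o′ yAxis (lit 3 4) (lit 4 4) (lit 5 5) (lit 5 5))

      ladder₂-side01 : ∀ {i} → On z (E 2F i) (W 2F) → On z (W 0F) (W 1F) → Meet (E 2F i , W 2F) (W 0F , W 1F) z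
      ladder₂-side01 {i} o o′ = ⊥-elim (separated o′ o xAxis (ℕP.<⇒≤ (corners-ordered {0F} {1F} (s≤s z≤n))) ℕP.≤-refl
        (ℕP.<-≤-trans w₁<w₂ (proj₁ (proj₁ (ladder-in-column 2F i)))) w₁<w₂)
        where w₁<w₂ = corners-ordered {1F} {2F} (s≤s (s≤s z≤n))

      ladder₂-side12 : ∀ {i} → On z (E 2F i) (W 2F) → On z (W 1F) (W 2F) → Meet (E 2F i , W 2F) (W 1F , W 2F) z
      ladder₂-side12 {i} o o′ = at (W 2F) second second (end-by-coord o′ xAxis
        (meet-on-line o′ o xAxis (ℕP.<⇒≤ w₁<w₂) ℕP.≤-refl (proj₁ (proj₁ (ladder-in-column 2F i))) ℕP.≤-refl)
        (ℕP.<⇒≢ w₁<w₂))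
        where w₁<w₂ = corners-ordered {1F} {2F} (s≤s (s≤s z≤n))

      ladder₂-side02 : ∀ {i} → On z (E 2F i) (W 2F) → On z (W 0F) (W 2F) → Meet (E 2F i , W 2F) (W 0F , W 2F) z
      ladder₂-side02 {i} o o′ = at (W 2F) second second (end-by-coord o′ xAxis
        (meet-on-line o′ o xAxis (ℕP.<⇒≤ w₀<w₂) ℕP.≤-refl (proj₁ (proj₁ (ladder-in-column 2F i))) ℕP.≤-refl)
        (ℕP.<⇒≢ w₀<w₂))
        where w₀<w₂ = corners-ordered {0F} {2F} (s≤s z≤n)

      side01-side12 : On z (W 0F) (W 1F) → On z (W 1F) (W 2F) → Meet (W 0F , W 1F) (W 1F , W 2F) z
      side01-side12 o o′ = at (W 1F) second first (end-by-coord o xAxis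
        (meet-on-line o o′ xAxis (ℕP.<⇒≤ w₀<w₁) ℕP.≤-refl ℕP.≤-refl (ℕP.<⇒≤ (corners-ordered {1F} {2F} (s≤s (s≤s z≤n)))))
        (ℕP.<⇒≢ w₀<w₁))
        where w₀<w₁ = corners-ordered {0F} {1F} (s≤s z≤n)

      side01-side02 : On z (W 0F) (W 1F) → On z (W 0F) (W 2F) → Meet (W 0F , W 1F) (W 0F , W 2F) z
      side01-side02 o o′ = at (W 0F) first first
        (start-by-coord o yAxis (meet-on-line o o′ yAxis (lit 5 5) (lit 4 5) (lit 5 5) (lit 5 5)) λ ())

      side12-side02 : On z (W 1F) (W 2F) → On z (W 0F) (W 2F) → Meet (W 1F , W 2F) (W 0F , W 2F) z
      side12-side02 o o′ = at (W 2F) second second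
        (end-by-coord o yAxis (meet-on-line o o′ yAxis (lit 4 5) (lit 5 5) (lit 5 5) (lit 5 5)) λ ())

    block-meet : ∀ l l′ {z} → OnEdge z (ends g l) → OnEdge z (ends g l′) → Meet (ends g l) (ends g l′) z
    block-meet (hubA _ _)       (hubA _ _)       o o′ = spokes refl refl o o′
    block-meet (hubA _ _)       (hubB _ _)       o o′ = spokes refl refl o o′
    block-meet (hubA _ _)       (fanAB _ _)      o o′ = spoke-base refl o o′
    block-meet (hubA _ _)       (fanLink _ _)    o o′ = spoke-riser refl o o′
    block-meet l@(hubA _ _)     l′@(linkCorner _ _) o o′ = ⊥-elim (apart-by-height l l′ o o′)
    block-meet l@(hubA _ _)     l′@corner01      o o′ = ⊥-elim (apart-by-height l l′ o o′)
    block-meet l@(hubA _ _)     l′@corner12      o o′ = ⊥-elim (apart-by-height l l′ o o′)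
    block-meet l@(hubA _ _)     l′@corner02      o o′ = ⊥-elim (apart-by-height l l′ o o′)
    block-meet (hubB _ _)       (hubA _ _)       o o′ = spokes refl refl o o′
    block-meet (hubB _ _)       (hubB _ _)       o o′ = spokes refl refl o o′
    block-meet (hubB _ _)       (fanAB _ _)      o o′ = spoke-base refl o o′
    block-meet (hubB _ _)       (fanLink _ _)    o o′ = spoke-riser refl o o′
    block-meet l@(hubB _ _)     l′@(linkCorner _ _) o o′ = ⊥-elim (apart-by-height l l′ o o′)
    block-meet l@(hubB _ _)     l′@corner01      o o′ = ⊥-elim (apart-by-height l l′ o o′)
    block-meet l@(hubB _ _)     l′@corner12      o o′ = ⊥-elim (apart-by-height l l′ o o′)
    block-meet l@(hubB _ _)     l′@corner02      o o′ = ⊥-elim (apart-by-height l l′ o o′)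
    block-meet (fanAB _ _)      (hubA _ _)       o o′ = Meet-swap (spoke-base refl o′ o)
    block-meet (fanAB _ _)      (hubB _ _)       o o′ = Meet-swap (spoke-base refl o′ o)
    block-meet (fanAB _ _)      (fanAB _ _)      o o′ = bases o o′
    block-meet (fanAB _ _)      (fanLink _ _)    o o′ = base-riser o o′
    block-meet l@(fanAB _ _)    l′@(linkCorner _ _) o o′ = ⊥-elim (apart-by-height l l′ o o′)
    block-meet l@(fanAB _ _)    l′@corner01      o o′ = ⊥-elim (apart-by-height l l′ o o′)
    block-meet l@(fanAB _ _)    l′@corner12      o o′ = ⊥-elim (apart-by-height l l′ o o′)
    block-meet l@(fanAB _ _)    l′@corner02      o o′ = ⊥-elim (apart-by-height l l′ o o′)
    block-meet (fanLink _ _)    (hubA _ _)       o o′ = Meet-swap (spoke-riser refl o′ o)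
    block-meet (fanLink _ _)    (hubB _ _)       o o′ = Meet-swap (spoke-riser refl o′ o)
    block-meet (fanLink _ _)    (fanAB _ _)      o o′ = Meet-swap (base-riser o′ o)
    block-meet (fanLink _ _)    (fanLink _ _)    o o′ = risers o o′
    block-meet (fanLink _ _)    (linkCorner _ _) o o′ = riser-ladder o o′
    block-meet l@(fanLink _ _)  l′@corner01      o o′ = ⊥-elim (apart-by-height l l′ o o′)
    block-meet l@(fanLink _ _)  l′@corner12      o o′ = ⊥-elim (apart-by-height l l′ o o′)
    block-meet l@(fanLink _ _)  l′@corner02      o o′ = ⊥-elim (apart-by-height l l′ o o′)
    block-meet l@(linkCorner _ _) l′@(hubA _ _)  o o′ = ⊥-elim (apart-by-height l′ l o′ o)
    block-meet l@(linkCorner _ _) l′@(hubB _ _)  o o′ = ⊥-elim (apart-by-height l′ l o′ o)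
    block-meet l@(linkCorner _ _) l′@(fanAB _ _) o o′ = ⊥-elim (apart-by-height l′ l o′ o)
    block-meet (linkCorner _ _) (fanLink _ _)    o o′ = Meet-swap (riser-ladder o′ o)
    block-meet (linkCorner _ _) (linkCorner _ _) o o′ = ladders o o′
    block-meet (linkCorner 0F _) corner01        o o′ = ladder₀-side01 o o′
    block-meet (linkCorner 1F _) corner01        o o′ = ladder₁-side01 o o′
    block-meet (linkCorner 2F _) corner01        o o′ = ladder₂-side01 o o′
    block-meet (linkCorner 0F _) corner12        o o′ = ladder₀-side12 o o′
    block-meet (linkCorner 1F _) corner12        o o′ = ladder₁-side12 o o′
    block-meet (linkCorner 2F _) corner12        o o′ = ladder₂-side12 o o′
    block-meet (linkCorner 0F _) corner02        o o′ = ladder₀-side02 o o′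
    block-meet (linkCorner 1F _) corner02        o o′ = ladder₁-side02 o o′
    block-meet (linkCorner 2F _) corner02        o o′ = ladder₂-side02 o o′
    block-meet l@corner01       l′@(hubA _ _)    o o′ = ⊥-elim (apart-by-height l′ l o′ o)
    block-meet l@corner01       l′@(hubB _ _)    o o′ = ⊥-elim (apart-by-height l′ l o′ o)
    block-meet l@corner01       l′@(fanAB _ _)   o o′ = ⊥-elim (apart-by-height l′ l o′ o)
    block-meet l@corner01       l′@(fanLink _ _) o o′ = ⊥-elim (apart-by-height l′ l o′ o)
    block-meet corner01         (linkCorner 0F _) o o′ = Meet-swap (ladder₀-side01 o′ o)
    block-meet corner01         (linkCorner 1F _) o o′ = Meet-swap (ladder₁-side01 o′ o)
    block-meet corner01         (linkCorner 2F _) o o′ = Meet-swap (ladder₂-side01 o′ o)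
    block-meet corner01         corner01         o o′ = same
    block-meet corner01         corner12         o o′ = side01-side12 o o′
    block-meet corner01         corner02         o o′ = side01-side02 o o′
    block-meet l@corner12       l′@(hubA _ _)    o o′ = ⊥-elim (apart-by-height l′ l o′ o)
    block-meet l@corner12       l′@(hubB _ _)    o o′ = ⊥-elim (apart-by-height l′ l o′ o)
    block-meet l@corner12       l′@(fanAB _ _)   o o′ = ⊥-elim (apart-by-height l′ l o′ o)
    block-meet l@corner12       l′@(fanLink _ _) o o′ = ⊥-elim (apart-by-height l′ l o′ o)
    block-meet corner12         (linkCorner 0F _) o o′ = Meet-swap (ladder₀-side12 o′ o)
    block-meet corner12         (linkCorner 1F _) o o′ = Meet-swap (ladder₁-side12 o′ o)
    block-meet corner12         (linkCorner 2F _) o o′ = Meet-swap (ladder₂-side12 o′ o)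
    block-meet corner12         corner01         o o′ = Meet-swap (side01-side12 o′ o)
    block-meet corner12         corner12         o o′ = same
    block-meet corner12         corner02         o o′ = side12-side02 o o′
    block-meet l@corner02       l′@(hubA _ _)    o o′ = ⊥-elim (apart-by-height l′ l o′ o)
    block-meet l@corner02       l′@(hubB _ _)    o o′ = ⊥-elim (apart-by-height l′ l o′ o)
    block-meet l@corner02       l′@(fanAB _ _)   o o′ = ⊥-elim (apart-by-height l′ l o′ o)
    block-meet l@corner02       l′@(fanLink _ _) o o′ = ⊥-elim (apart-by-height l′ l o′ o)
    block-meet corner02         (linkCorner 0F _) o o′ = Meet-swap (ladder₀-side02 o′ o)
    block-meet corner02         (linkCorner 1F _) o o′ = Meet-swap (ladder₁-side02 o′ o)
    block-meet corner02         (linkCorner 2F _) o o′ = Meet-swap (ladder₂-side02 o′ o)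
    block-meet corner02         corner01         o o′ = Meet-swap (side01-side02 o′ o)
    block-meet corner02         corner12         o o′ = Meet-swap (side12-side02 o′ o)
    block-meet corner02         corner02         o o′ = same

module Embedding (m : ℕ) where

  open Construction (suc m)
  open Geometry
  open Layout m
  open BlockEdges m
  open import Defs using (Point; OnSegment; Planar; Edge)
  open Encoding (suc m)
  open GraphG (suc m)
  open import Function.Definitions using (Injective)
  open import Data.Nat using (_+_; _≤_; _<_; z≤n; s≤s; _≤ᵇ_)
  import Data.Nat.Properties as ℕP
  open import Data.Fin using (Fin; zero; toℕ)
  open import Data.Fin.Patterns using (0F; 1F; 2F)
  open import Data.Fin.Properties using (toℕ-injective)
  open import Data.Bool using (T)
  open import Data.Product using (Σ; _×_; _,_; proj₁; proj₂)
  open import Data.Sum using (_⊎_; inj₁; inj₂)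
  open import Data.Empty using (⊥; ⊥-elim)
  open import Relation.Binary.PropositionalEquality
  open import Relation.Binary.Definitions using (tri<; tri≈; tri>)
  open import Relation.Nullary using (¬_)

  data HubEdge : Set where
    hub01 hub12 hub02 : HubEdge

  H : Fin 3 → Vertex
  H g = g , hub

  hubEnds : HubEdge → Ends
  hubEnds hub01 = H 0F , H 1F
  hubEnds hub12 = H 1F , H 2F
  hubEnds hub02 = H 0F , H 2F

  private
    H₀<H₁ : xOf (H 0F) < xOf (H 1F)
    H₀<H₁ = ℕP.<-≤-trans (blocks-ordered {0F} {1F} (s≤s z≤n)) (ℕP.m≤m+n _ 0)

    H₁<H₂ : xOf (H 1F) < xOf (H 2F)
    H₁<H₂ = ℕP.≤-<-trans (ℕP.+-monoʳ-≤ (offset 1F) z≤n)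
                         (ℕP.<-≤-trans (blocks-ordered {1F} {2F} (s≤s (s≤s z≤n))) (ℕP.m≤m+n _ 0))

    H₀<H₂ : xOf (H 0F) < xOf (H 2F)
    H₀<H₂ = ℕP.<-trans H₀<H₁ H₁<H₂

    in-strip : ∀ g u → offset g ≤ xOf (g , u) × xOf (g , u) ≤ offset g + width
    in-strip g u = ℕP.m≤m+n (offset g) (localX g u) , ℕP.+-monoʳ-≤ (offset g) (localX≤width g u)

    H₂-leftmost : ∀ u → xOf (H 2F) ≤ xOf (2F , u)
    H₂-leftmost u = subst (_≤ xOf (2F , u)) (sym (ℕP.+-identityʳ (offset 2F))) (proj₁ (in-strip 2F u))

    hub-edge-low : ∀ h → yOf (proj₁ (hubEnds h)) ≤ 1 × yOf (proj₂ (hubEnds h)) ≤ 1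
    hub-edge-low hub01 = z≤n , ℕP.≤-refl
    hub-edge-low hub12 = ℕP.≤-refl , z≤n
    hub-edge-low hub02 = z≤n , z≤n

    below-block : ∀ {z g} h l → {T (2 ≤ᵇ bottom l)} → OnEdge z (hubEnds h) → OnEdge z (ends g l) → ⊥
    below-block {g = g} h l {2≤l} o o′ = separated o o′ yAxis (proj₁ (hub-edge-low h)) (proj₂ (hub-edge-low h))
      (ℕP.≤-trans (lit 2 (bottom l) {2≤l}) (proj₁ (proj₁ (in-band g l))))
      (ℕP.≤-trans (lit 2 (bottom l) {2≤l}) (proj₁ (proj₂ (in-band g l))))

  module _ {z : Point} where
    hub-edges : ∀ h h′ → OnEdge z (hubEnds h) → OnEdge z (hubEnds h′) → Meet (hubEnds h) (hubEnds h′) z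
    hub-edges hub01 hub01 o o′ = same
    hub-edges hub12 hub12 o o′ = same
    hub-edges hub02 hub02 o o′ = same
    hub-edges hub01 hub12 o o′ = at (H 1F) second first (end-by-coord o xAxis
      (meet-on-line o o′ xAxis (ℕP.<⇒≤ H₀<H₁) ℕP.≤-refl ℕP.≤-refl (ℕP.<⇒≤ H₁<H₂)) (ℕP.<⇒≢ H₀<H₁))
    hub-edges hub12 hub01 o o′ = Meet-swap (hub-edges hub01 hub12 o′ o)
    hub-edges hub01 hub02 o o′ = at (H 0F) first first
      (start-by-coord o yAxis (meet-on-line o′ o yAxis z≤n z≤n z≤n z≤n) λ ())
    hub-edges hub02 hub01 o o′ = Meet-swap (hub-edges hub01 hub02 o′ o)
    hub-edges hub12 hub02 o o′ = at (H 2F) second second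
      (end-by-coord o yAxis (meet-on-line o′ o yAxis z≤n z≤n z≤n z≤n) λ ())
    hub-edges hub02 hub12 o o′ = Meet-swap (hub-edges hub12 hub02 o′ o)

    hub-spoke : ∀ h g {u} → height g u ≡ 2 → OnEdge z (hubEnds h) → On z (H g) (g , u) →
                Meet (hubEnds h) (H g , (g , u)) z
    hub-spoke hub01 0F {u} _ o o′ = at (H 0F) first first (start-by-coord o xAxis
      (meet-on-line o′ o xAxis ℕP.≤-refl (proj₂ (in-strip 0F u)) ℕP.≤-refl (ℕP.<⇒≤ H₀<H₁)) (ℕP.>⇒≢ H₀<H₁))
    hub-spoke hub01 1F u2 o o′ = at (H 1F) second first (end-by-coord o yAxis
      (meet-on-line o o′ yAxis z≤n ℕP.≤-refl ℕP.≤-refl (subst (1 ≤_) (sym u2) (lit 1 2))) λ ())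
    hub-spoke hub01 2F {u} _ o o′ = ⊥-elim (separated o o′ xAxis (ℕP.<⇒≤ H₀<H₁) ℕP.≤-refl H₁<H₂
      (ℕP.<-≤-trans H₁<H₂ (H₂-leftmost u)))
    hub-spoke hub12 0F {u} _ o o′ = ⊥-elim (separated o′ o xAxis ℕP.≤-refl (proj₂ (in-strip 0F u)) H₀<H₁ H₀<H₂)
    hub-spoke hub12 1F u2 o o′ = at (H 1F) first first (start-by-coord o yAxis
      (meet-on-line o o′ yAxis ℕP.≤-refl z≤n ℕP.≤-refl (subst (1 ≤_) (sym u2) (lit 1 2))) λ ())
    hub-spoke hub12 2F {u} _ o o′ = at (H 2F) second first (end-by-coord o xAxis
      (meet-on-line o o′ xAxis (ℕP.<⇒≤ H₁<H₂) ℕP.≤-refl ℕP.≤-refl (H₂-leftmost u)) (ℕP.<⇒≢ H₁<H₂))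
    hub-spoke hub02 0F {u} _ o o′ = at (H 0F) first first (start-by-coord o xAxis
      (meet-on-line o′ o xAxis ℕP.≤-refl (proj₂ (in-strip 0F u)) ℕP.≤-refl (ℕP.<⇒≤ H₀<H₂)) (ℕP.>⇒≢ H₀<H₂))
    hub-spoke hub02 1F u2 o o′ = ⊥-elim (separated o o′ yAxis z≤n z≤n ℕP.≤-refl (subst (1 ≤_) (sym u2) (lit 1 2)))
    hub-spoke hub02 2F {u} _ o o′ = at (H 2F) second first (end-by-coord o xAxis
      (meet-on-line o o′ xAxis (ℕP.<⇒≤ H₀<H₂) ℕP.≤-refl ℕP.≤-refl (H₂-leftmost u)) (ℕP.<⇒≢ H₀<H₂))

    -- hub edges lie at height at most 1, the block edges other than the
    -- spokes at height at least 2
    hub-block : ∀ h g l → OnEdge z (hubEnds h) → OnEdge z (ends g l) → Meet (hubEnds h) (ends g l) z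
    hub-block h g (hubA _ _)         o o′ = hub-spoke h g refl o o′
    hub-block h g (hubB _ _)         o o′ = hub-spoke h g refl o o′
    hub-block h g l@(fanAB _ _)      o o′ = ⊥-elim (below-block h l o o′)
    hub-block h g l@(fanLink _ _)    o o′ = ⊥-elim (below-block h l o o′)
    hub-block h g l@(linkCorner _ _) o o′ = ⊥-elim (below-block h l o o′)
    hub-block h g l@corner01         o o′ = ⊥-elim (below-block h l o o′)
    hub-block h g l@corner12         o o′ = ⊥-elim (below-block h l o o′)
    hub-block h g l@corner02         o o′ = ⊥-elim (below-block h l o o′)

  blocks-apart : ∀ {z g g′} l l′ → toℕ g < toℕ g′ → OnEdge z (ends g l) → OnEdge z (ends g′ l′) → ⊥
  blocks-apart {g = g} {g′} l l′ g<g′ o o′ =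
    separated o o′ xAxis (proj₂ (in-strip g (proj₁ (pieces l)))) (proj₂ (in-strip g (proj₂ (pieces l))))
      (ℕP.<-≤-trans (blocks-ordered g<g′) (proj₁ (in-strip g′ (proj₁ (pieces l′)))))
      (ℕP.<-≤-trans (blocks-ordered g<g′) (proj₁ (in-strip g′ (proj₂ (pieces l′)))))

  data Segment : Set where
    between : HubEdge → Segment
    inside  : Fin 3 → BlockEdge → Segment

  segment-ends : Segment → Ends
  segment-ends (between h)  = hubEnds h
  segment-ends (inside g l) = ends g l

  segments-meet : ∀ s s′ {z} → OnEdge z (segment-ends s) → OnEdge z (segment-ends s′) →
                  Meet (segment-ends s) (segment-ends s′) z
  segments-meet (between h)  (between h′)   o o′ = hub-edges h h′ o o′
  segments-meet (between h)  (inside g l)   o o′ = hub-block h g l o o′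
  segments-meet (inside g l) (between h)    o o′ = Meet-swap (hub-block h g l o′ o)
  segments-meet (inside g l) (inside g′ l′) o o′ with ℕP.<-cmp (toℕ g) (toℕ g′)
  ... | tri< g<g′ _ _ = ⊥-elim (blocks-apart l l′ g<g′ o o′)
  ... | tri> _ _ g′<g = ⊥-elim (blocks-apart l′ l g′<g o′ o)
  ... | tri≈ _ g≡g′ _ with toℕ-injective g≡g′
  ...   | refl = InBlock.block-meet g l l′ o o′

  Drawn : Vertex → Vertex → Set
  Drawn x y = Σ Segment λ s → segment-ends s ≡ (x , y) ⊎ segment-ends s ≡ (y , x)

  drawn : ∀ {x y} → Adj x y → Drawn x y
  drawn (hub-hub {0F} {0F} g≢g)   = ⊥-elim (g≢g refl)
  drawn (hub-hub {0F} {1F} _)     = between hub01 , inj₁ refl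
  drawn (hub-hub {0F} {2F} _)     = between hub02 , inj₁ refl
  drawn (hub-hub {1F} {0F} _)     = between hub01 , inj₂ refl
  drawn (hub-hub {1F} {1F} g≢g)   = ⊥-elim (g≢g refl)
  drawn (hub-hub {1F} {2F} _)     = between hub12 , inj₁ refl
  drawn (hub-hub {2F} {0F} _)     = between hub02 , inj₂ refl
  drawn (hub-hub {2F} {1F} _)     = between hub12 , inj₂ refl
  drawn (hub-hub {2F} {2F} g≢g)   = ⊥-elim (g≢g refl)
  drawn (hub-fanA {g} {j} {i})    = inside g (hubA j i) , inj₁ refl
  drawn (fanA-hub {g} {j} {i})    = inside g (hubA j i) , inj₂ refl
  drawn (hub-fanB {g} {j} {i})    = inside g (hubB j i) , inj₁ refl
  drawn (fanB-hub {g} {j} {i})    = inside g (hubB j i) , inj₂ refl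
  drawn (fanA-fanB {g} {j} {i})   = inside g (fanAB j i) , inj₁ refl
  drawn (fanB-fanA {g} {j} {i})   = inside g (fanAB j i) , inj₂ refl
  drawn (fanA-link {g} {j} {i})   = inside g (fanLink j i) , inj₁ refl
  drawn (link-fanA {g} {j} {i})   = inside g (fanLink j i) , inj₂ refl
  drawn (link-corner {g} {j} {i}) = inside g (linkCorner j i) , inj₁ refl
  drawn (corner-link {g} {j} {i}) = inside g (linkCorner j i) , inj₂ refl
  drawn (corner-corner {g} {0F} {0F} j≢j) = ⊥-elim (j≢j refl)
  drawn (corner-corner {g} {0F} {1F} _)   = inside g corner01 , inj₁ refl
  drawn (corner-corner {g} {0F} {2F} _)   = inside g corner02 , inj₁ refl
  drawn (corner-corner {g} {1F} {0F} _)   = inside g corner01 , inj₂ refl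
  drawn (corner-corner {g} {1F} {1F} j≢j) = ⊥-elim (j≢j refl)
  drawn (corner-corner {g} {1F} {2F} _)   = inside g corner12 , inj₁ refl
  drawn (corner-corner {g} {2F} {0F} _)   = inside g corner02 , inj₂ refl
  drawn (corner-corner {g} {2F} {1F} _)   = inside g corner12 , inj₂ refl
  drawn (corner-corner {g} {2F} {2F} j≢j) = ⊥-elim (j≢j refl)

  edges-meet : ∀ {u v x y z} → Adj u v → Adj x y → On z u v → On z x y → Meet (u , v) (x , y) z
  edges-meet {u} {v} {x} {y} {z} uv xy o o′ = oriented (drawn uv) (drawn xy)
    where
    meet : ∀ {e e′} s s′ → segment-ends s ≡ e → segment-ends s′ ≡ e′ → OnEdge z e → OnEdge z e′ → Meet e e′ z
    meet s s′ refl refl = segments-meet s s′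
    oriented : Drawn u v → Drawn x y → Meet (u , v) (x , y) z
    oriented (s , inj₁ e) (s′ , inj₁ e′) = meet s s′ e e′ o o′
    oriented (s , inj₂ e) (s′ , inj₁ e′) = Meet-swap (Meet-reverse (Meet-swap (meet s s′ e e′ (On-sym o) o′)))
    oriented (s , inj₁ e) (s′ , inj₂ e′) = Meet-reverse (meet s s′ e e′ o (On-sym o′))
    oriented (s , inj₂ e) (s′ , inj₂ e′) =
      Meet-swap (Meet-reverse (Meet-swap (Meet-reverse (meet s s′ e e′ (On-sym o) (On-sym o′)))))

  neighbour : ∀ w → Σ Vertex (Adj w)
  neighbour (g , hub)      = (g , fanA 0F zero) , hub-fanA
  neighbour (g , corner j) = (g , link j zero) , corner-link
  neighbour (g , fanA j i) = (g , hub) , fanA-hub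
  neighbour (g , fanB j i) = (g , hub) , fanB-hub
  neighbour (g , link j i) = (g , fanA j i) , link-fanA

  -- A vertex w lies on no edge it is not an end of: otherwise that edge
  -- would meet an edge at w in the point w.
  vertex-off-edge : ∀ {u v w} → Adj u v → w ≢ u → w ≢ v → ¬ On ⟦ pos w ⟧ u v
  vertex-off-edge {u} {v} {w} uv w≢u w≢v o =
    excluded (edges-meet uv (proj₂ (neighbour w)) o (on (start-on-segment ⟦ pos w ⟧ ⟦ pos (proj₁ (neighbour w)) ⟧)))
    where
    excluded : ¬ Meet (u , v) (w , proj₁ (neighbour w)) ⟦ pos w ⟧
    excluded (inj₁ (inj₁ (u≡w , _)))         = w≢u (sym u≡w)
    excluded (inj₁ (inj₂ (_ , v≡w)))         = w≢v (sym v≡w)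
    excluded (inj₂ (c , inj₁ c≡u , _ , w≡c)) = w≢u (trans (pos-injective (⟦⟧-injective w≡c)) c≡u)
    excluded (inj₂ (c , inj₂ c≡v , _ , w≡c)) = w≢v (trans (pos-injective (⟦⟧-injective w≡c)) c≡v)

  planar : Planar G
  planar = position , position-injective , off-edge , edges-meet′
    where
    position : Fin N → Point
    position x = ⟦ pos (decode x) ⟧

    position-injective : Injective _≡_ _≡_ position
    position-injective e = decode-injective (pos-injective (⟦⟧-injective e))

    off-edge : ∀ u v w → Edge G u v → w ≢ u → w ≢ v → ¬ OnSegment (position w) (position u) (position v)
    off-edge u v w uv w≢u w≢v o =
      vertex-off-edge (edge⇒Adj uv) (λ e → w≢u (decode-injective e)) (λ e → w≢v (decode-injective e)) (on o)

    encoded : ∀ {c u v} → Endpoint c (decode u , decode v) → encode c ≡ u ⊎ encode c ≡ v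
    encoded {c} {u} {v} (inj₁ c≡u) = inj₁ (trans (cong encode c≡u) (encode-decode u))
    encoded {c} {u} {v} (inj₂ c≡v) = inj₂ (trans (cong encode c≡v) (encode-decode v))

    edges-meet′ : ∀ u v x y (z : Point) → Edge G u v → Edge G x y →
                  OnSegment z (position u) (position v) → OnSegment z (position x) (position y) →
                  ((u ≡ x × v ≡ y) ⊎ (u ≡ y × v ≡ x))
                  ⊎ Σ (Fin N) λ w → (w ≡ u ⊎ w ≡ v) × (w ≡ x ⊎ w ≡ y) × (z ≡ position w)
    edges-meet′ u v x y z uv xy o o′ with edges-meet (edge⇒Adj uv) (edge⇒Adj xy) (on o) (on o′)
    ... | inj₁ (inj₁ (u≡x , v≡y)) = inj₁ (inj₁ (decode-injective u≡x , decode-injective v≡y))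
    ... | inj₁ (inj₂ (u≡y , v≡x)) = inj₁ (inj₂ (decode-injective u≡y , decode-injective v≡x))
    ... | inj₂ (c , c∈uv , c∈xy , z≡c) =
      inj₂ (encode c , encoded c∈uv , encoded c∈xy , trans z≡c (cong (λ w → ⟦ pos w ⟧) (sym (decode-encode c))))

open import Defs using (Graph; Planar; HasCycle; Colorable)
open import Data.Nat using (_+_; _≤_)
open import Data.Product using (Σ; _×_; _,_)
open import Relation.Nullary using (¬_)

-- The graph for M = 2k+1.
mainTheorem2 : (k : ℕ) → 1 ≤ k →
    Σ Graph λ G → Planar G × ¬ HasCycle G 4 × ¬ HasCycle G 5 × ¬ Colorable G 1 k
mainTheorem2 k _ = G , planar , no-C4 , no-C5 , not-colourable
  where
  open GraphG (suc (k + k)) using (G)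
  open Embedding (k + k) using (planar)
  open CyclesOfG (suc (k + k)) using (no-C4; no-C5)
  open Colouring k using (not-colourable)
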